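{- Let $n>k\ge1$, $\lambda,\mu\in P_{kn}$, $d\ge0$ an integer and $\beta=(\beta_1,\dots,\beta_l)$ a vector of nonnegative integers. The quantum Kostka number $K^\beta_{\lambda/d/\mu}$ is invariant under permutations of the entries $\beta_1,\dots,\beta_l$ of $\beta$.
   Context: $P_{kn}$ is the set of partitions $\lambda=(\lambda_1\ge\dots\ge\lambda_k\ge0)$ with $\lambda_1\le n-k$. Let $\mathcal{C}_{kn}=\mathbb{Z}^2/(-k,n-k)\mathbb{Z}$, $\langle i,j\rangle$ the class of $(i,j)$. For $\lambda\in P_{kn}$, $r\in\mathbb{Z}$, $\lambda[r]$ is the sequence with $\lambda[r]_{i+r}=\lambda_i+r$ ($i=1,\dots,k$) and $\lambda[r]_i=\lambda[r]_{i+k}+(n-k)$ for all $i$. The cylindric diagram of shape $\lambda/d/\mu$ is $D=\{\langle i,j\rangle:(i,j)\in\mathbb{Z}^2,\ \mu[0]_i<j\le\lambda[d]_i\}\subset\mathcal{C}_{kn}$. A semi-standard cylindric tableau of shape $\lambda/d/\mu$ and weight $\beta$ is a map $T:D\to\mathbb{Z}_{>0}$ with $\#T^{ -1}(m)=\beta_m$ for $m=1,\dots,l$ (and no other values), such that $T(\langle i,j\rangle)\le T(\langle i,j+1\rangle)$ and $T(\langle i,j\rangle)<T(\langle i+1,j\rangle)$ whenever both arguments lie in $D$. The quantum Kostka number $K^\beta_{\lambda/d/\mu}$ is the number of such tableaux. -}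

module Defs where

open import Data.Nat as ℕ using (ℕ; zero; suc; NonZero; _∸_)
open import Data.Integer as ℤ using (ℤ; +_; -[1+_]; _/ℕ_; _%ℕ_)
open import Data.Integer.DivMod using (n%ℕd<d)
open import Data.Fin as Fin using (Fin; fromℕ<)
open import Data.Vec using (Vec; lookup)
open import Data.List using (List; []; _∷_; map; concatMap; upTo; filterᵇ; length; foldr; _++_)
open import Data.Bool using (Bool; true; false; _∧_; if_then_else_)
open import Data.Product using (_×_; _,_; proj₁; proj₂)
open import Relation.Nullary.Decidable using (⌊_⌋)

-- Partitions: P_kn = { λ = (λ_1 ≥ … ≥ λ_k ≥ 0) | λ_1 ≤ n - k }.
-- A partition is a vector (λ_1,…,λ_k); entry λ_i is  lookup lam (i-1).

IsPartition : (k n : ℕ) → Vec ℕ k → Set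
IsPartition k n lam =
  (∀ (i j : Fin k) → i Fin.≤ j → lookup lam j ℕ.≤ lookup lam i)
  × (∀ (i : Fin k) → lookup lam i ℕ.≤ n ∸ k)

-- The shifted sequence λ[r] : ℤ → ℤ, determined by
--   λ[r]_{i+r} = λ_i + r  (i = 1..k),   λ[r]_i = λ[r]_{i+k} + (n-k).

shiftSeq : (k n : ℕ) .{{_ : NonZero k}} → Vec ℕ k → ℤ → ℤ → ℤ
shiftSeq k n lam r j =
  + lookup lam (fromℕ< (n%ℕd<d t k)) ℤ.+ r ℤ.- (t /ℕ k) ℤ.* + (n ∸ k)
  where t = j ℤ.- r ℤ.- ℤ.1ℤ

-- Cells of ℤ² and the cylinder C_kn = ℤ² / (-k, n-k)ℤ.
-- A class ⟨i,j⟩ is represented by its unique representative with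
-- 1 ≤ i ≤ k:  (i' + m k , j) ~ (i' , j + m (n-k)).

Cell : Set
Cell = ℤ × ℤ

rep : (k n : ℕ) .{{_ : NonZero k}} → Cell → Cell
rep k n (i , j) = (+ suc (t %ℕ k)) , (j ℤ.+ (t /ℕ k) ℤ.* + (n ∸ k))
  where t = i ℤ.- ℤ.1ℤ

_==ᶜ_ : Cell → Cell → Bool
(a , b) ==ᶜ (c , d) = ⌊ a ℤ.≟ c ⌋ ∧ ⌊ b ℤ.≟ d ⌋

-- membership of ⟨i,j⟩ in the cylindric diagram of shape λ/d/μ:
--   μ[0]_i < j ≤ λ[d]_i   (this condition is invariant under the shift).
inD : (k n : ℕ) .{{_ : NonZero k}} → Vec ℕ k → ℕ → Vec ℕ k → Cell → Bool
inD k n lam d mu (i , j) =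
  ((shiftSeq k n mu (+ 0) i ℤ.+ ℤ.1ℤ) ℤ.≤ᵇ j) ∧ (j ℤ.≤ᵇ shiftSeq k n lam (+ d) i)

range : ℤ → ℕ → List ℤ
range a zero    = []
range a (suc c) = a ∷ range (a ℤ.+ ℤ.1ℤ) c

pos : ℤ → ℕ
pos (+ m)     = m
pos -[1+ m ]  = 0

-- The cylindric diagram D ⊂ C_kn, listed by its representatives (i , j)
-- with 1 ≤ i ≤ k and μ[0]_i < j ≤ λ[d]_i (each class exactly once).
diagram : (k n : ℕ) .{{_ : NonZero k}} → Vec ℕ k → ℕ → Vec ℕ k → List Cell
diagram k n lam d mu =
  concatMap
    (λ s → let i  = + suc s
               lo = shiftSeq k n mu (+ 0) i
               hi = shiftSeq k n lam (+ d) i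
           in map (λ j → (i , j)) (range (lo ℤ.+ ℤ.1ℤ) (pos (hi ℤ.- lo))))
    (upTo k)

-- Fillings: maps T : D → {1,…,l}, encoded as association lists
-- (one entry per cell of D, in the order of `diagram`).

Filling : Set
Filling = List (Cell × ℕ)

allFillings : ℕ → List Cell → List Filling
allFillings l []       = [] ∷ []
allFillings l (c ∷ cs) =
  concatMap (λ v → map ((c , suc v) ∷_) (allFillings l cs)) (upTo l)

-- value of a filling at a cell (0 if absent; only used on cells of D)
valueAt : Filling → Cell → ℕ
valueAt []             c = 0
valueAt ((c' , v) ∷ F) c = if c' ==ᶜ c then v else valueAt F c

allᵇ : {A : Set} → (A → Bool) → List A → Bool
allᵇ p = foldr (λ x b → p x ∧ b) true

countᵇ : {A : Set} → (A → Bool) → List A → ℕ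
countᵇ p xs = length (filterᵇ p xs)

listEqᵇ : List ℕ → List ℕ → Bool
listEqᵇ []       []       = true
listEqᵇ (x ∷ xs) (y ∷ ys) = (x ℕ.≡ᵇ y) ∧ listEqᵇ xs ys
listEqᵇ _        _        = false

isSSCT : (k n : ℕ) .{{_ : NonZero k}} → Vec ℕ k → ℕ → Vec ℕ k →
         List ℕ → Filling → Bool
isSSCT k n lam d mu β F =
  allᵇ ok F ∧ listEqᵇ (map (λ m → countᵇ (λ cv → proj₂ cv ℕ.≡ᵇ suc m) F)
                           (upTo (length β))) β
  where
  ok : Cell × ℕ → Bool
  ok ((i , j) , v) =
    (if inD k n lam d mu (i , j ℤ.+ ℤ.1ℤ)
       then v ℕ.≤ᵇ valueAt F (rep k n (i , j ℤ.+ ℤ.1ℤ)) else true)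
    ∧
    (if inD k n lam d mu (i ℤ.+ ℤ.1ℤ , j)
       then suc v ℕ.≤ᵇ valueAt F (rep k n (i ℤ.+ ℤ.1ℤ , j)) else true)

quantumKostka : (k n : ℕ) .{{_ : NonZero k}} → Vec ℕ k → ℕ → Vec ℕ k →
                List ℕ → ℕ
quantumKostka k n lam d mu β =
  countᵇ (isSSCT k n lam d mu β)
         (allFillings (length β) (diagram k n lam d mu))

-- Bender–Knuth involution on cylindric tableaux. Unrolling the cylinder turns a
-- tableau into a k-periodic filling of rows indexed by ℤ. Fix a and b = a + 1.
-- An entry a with b directly below it, and an entry b with a directly above it,
-- are paired; the remaining a's and b's of a row are free and form a block of
-- r a's followed by s b's, which the move replaces by s a's followed by r b's.
-- The result is again semistandard, the move is an involution, and it exchanges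
-- the numbers of a's and b's, because over one period the a's paired downwards
-- and the b's paired upwards are equinumerous. So K^β is invariant under
-- adjacent transpositions of β, hence under all permutations.
module Submission where

open import Data.Nat using (ℕ; NonZero)
open import Data.Vec using (Vec)
open import Defs using (IsPartition)

module BoolReflection where

  open import Data.Bool using (Bool; true; false; _∧_; _∨_; not; T; if_then_else_)
  open import Data.Nat using (_≤_; _<_; _≡ᵇ_; _<ᵇ_; _≤ᵇ_)
  open import Data.Nat.Properties using (≡ᵇ⇒≡; ≡⇒≡ᵇ; <ᵇ⇒<; <⇒<ᵇ; ≤ᵇ⇒≤; ≤⇒≤ᵇ; ≮⇒≥)
  open import Data.Empty using (⊥-elim)
  open import Data.Product using (_×_; _,_)
  open import Data.Sum using (_⊎_; inj₁; inj₂)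
  open import Relation.Binary.PropositionalEquality
  open import Relation.Nullary using (¬_)

  true≢false : true ≢ false
  true≢false ()

  T⇒≡true : ∀ {b} → T b → b ≡ true
  T⇒≡true {true} _ = refl

  ≡true⇒T : ∀ {b} → b ≡ true → T b
  ≡true⇒T refl = _

  bool-cases : ∀ {X : Set} (b : Bool) → (b ≡ true → X) → (b ≡ false → X) → X
  bool-cases true  t f = t refl
  bool-cases false t f = f refl

  ≢true⇒≡false : ∀ {b} → ¬ (b ≡ true) → b ≡ false
  ≢true⇒≡false {true}  b≢true = ⊥-elim (b≢true refl)
  ≢true⇒≡false {false} _      = refl

  ≢false⇒≡true : ∀ {b} → ¬ (b ≡ false) → b ≡ true
  ≢false⇒≡true {true}  _       = refl
  ≢false⇒≡true {false} b≢false = ⊥-elim (b≢false refl)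

  ≡ᵇ-sound : ∀ {m n} → (m ≡ᵇ n) ≡ true → m ≡ n
  ≡ᵇ-sound {m} {n} e = ≡ᵇ⇒≡ m n (≡true⇒T e)

  ≡ᵇ-complete : ∀ {m n} → m ≡ n → (m ≡ᵇ n) ≡ true
  ≡ᵇ-complete {m} {n} e = T⇒≡true (≡⇒≡ᵇ m n e)

  ≡ᵇ-refl : ∀ n → (n ≡ᵇ n) ≡ true
  ≡ᵇ-refl n = ≡ᵇ-complete {n} refl

  ≡ᵇ-false : ∀ {m n} → m ≢ n → (m ≡ᵇ n) ≡ false
  ≡ᵇ-false m≢n = ≢true⇒≡false (λ e → m≢n (≡ᵇ-sound e))

  ≡ᵇ-false-sound : ∀ {m n} → (m ≡ᵇ n) ≡ false → m ≢ n
  ≡ᵇ-false-sound {m} e refl = true≢false (trans (sym (≡ᵇ-complete {m} refl)) e)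

  <ᵇ-sound : ∀ {m n} → (m <ᵇ n) ≡ true → m < n
  <ᵇ-sound {m} {n} e = <ᵇ⇒< m n (≡true⇒T e)

  <ᵇ-complete : ∀ {m n} → m < n → (m <ᵇ n) ≡ true
  <ᵇ-complete m<n = T⇒≡true (<⇒<ᵇ m<n)

  <ᵇ-false-sound : ∀ {m n} → (m <ᵇ n) ≡ false → n ≤ m
  <ᵇ-false-sound e = ≮⇒≥ (λ m<n → true≢false (trans (sym (<ᵇ-complete m<n)) e))

  ≤ᵇ-sound : ∀ {m n} → (m ≤ᵇ n) ≡ true → m ≤ n
  ≤ᵇ-sound {m} {n} e = ≤ᵇ⇒≤ m n (≡true⇒T e)

  ≤ᵇ-complete : ∀ {m n} → m ≤ n → (m ≤ᵇ n) ≡ true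
  ≤ᵇ-complete m≤n = T⇒≡true (≤⇒≤ᵇ m≤n)

  ∧-true⁻ : ∀ {x y} → x ∧ y ≡ true → x ≡ true × y ≡ true
  ∧-true⁻ {true} {true} _ = refl , refl

  ∧-true⁺ : ∀ {x y} → x ≡ true → y ≡ true → x ∧ y ≡ true
  ∧-true⁺ refl refl = refl

  ∧-falseˡ : ∀ {x} y → x ≡ false → x ∧ y ≡ false
  ∧-falseˡ y refl = refl

  ∧-falseʳ : ∀ x {y} → y ≡ false → x ∧ y ≡ false
  ∧-falseʳ true  refl = refl
  ∧-falseʳ false refl = refl

  if-true⁻ : ∀ {c u} → (if c then u else true) ≡ true → c ≡ true → u ≡ true
  if-true⁻ e refl = e

  if-true⁺ : ∀ c {u} → (c ≡ true → u ≡ true) → (if c then u else true) ≡ true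
  if-true⁺ true  h = h refl
  if-true⁺ false h = refl

  guarded-choice⁻ : ∀ c u p v q → c ∧ ((u ∧ not p) ∨ (v ∧ not q)) ≡ true →
                    c ≡ true × ((u ≡ true × p ≡ false) ⊎ (v ≡ true × q ≡ false))
  guarded-choice⁻ true true  false v    q     _ = refl , inj₁ (refl , refl)
  guarded-choice⁻ true true  true  true false _ = refl , inj₂ (refl , refl)
  guarded-choice⁻ true false p     true false _ = refl , inj₂ (refl , refl)

  guarded-choice⁺ˡ : ∀ {c u p} v q → c ≡ true → u ≡ true → p ≡ false →
                     c ∧ ((u ∧ not p) ∨ (v ∧ not q)) ≡ true
  guarded-choice⁺ˡ v q refl refl refl = refl

  guarded-choice⁺ʳ : ∀ {c v q} u p → c ≡ true → v ≡ true → q ≡ false →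
                     c ∧ ((u ∧ not p) ∨ (v ∧ not q)) ≡ true
  guarded-choice⁺ʳ true  true  refl refl refl = refl
  guarded-choice⁺ʳ true  false refl refl refl = refl
  guarded-choice⁺ʳ false p     refl refl refl = refl

module Counting where

  open import Data.Bool using (Bool; true; false; _∧_; not)
  open import Data.Nat
  open import Data.Nat.Properties
  open import Data.Nat.Tactic.RingSolver using (solve-∀)
  open import Relation.Binary.PropositionalEquality
  open import Relation.Nullary using (yes; no)
  open BoolReflection

  bit : Bool → ℕ
  bit true  = 1
  bit false = 0

  count : (ℕ → Bool) → ℕ → ℕ
  count p zero    = 0
  count p (suc n) = count p n + bit (p n)

  count-cong : ∀ {p q : ℕ → Bool} n → (∀ x → x < n → p x ≡ q x) → count p n ≡ count q n
  count-cong zero    h = refl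
  count-cong (suc n) h = cong₂ _+_ (count-cong n (λ x x<n → h x (m<n⇒m<1+n x<n))) (cong bit (h n ≤-refl))

  count-split : ∀ {p q r : ℕ → Bool} n → (∀ x → x < n → bit (p x) ≡ bit (q x) + bit (r x)) →
                count p n ≡ count q n + count r n
  count-split zero h = refl
  count-split {p} {q} {r} (suc n) h
    rewrite count-split {p} {q} {r} n (λ x x<n → h x (m<n⇒m<1+n x<n)) | h n ≤-refl =
    interchange (count q n) (count r n) (bit (q n)) (bit (r n))
    where
    interchange : ∀ a b c d → a + b + (c + d) ≡ a + c + (b + d)
    interchange = solve-∀

  count-mono-⊆ : ∀ {p q : ℕ → Bool} n → (∀ x → x < n → p x ≡ true → q x ≡ true) → count p n ≤ count q n
  count-mono-⊆ zero    h = z≤n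
  count-mono-⊆ (suc n) h = +-mono-≤ (count-mono-⊆ n (λ x x<n → h x (m<n⇒m<1+n x<n))) (bit-mono (h n ≤-refl))
    where
    bit-mono : ∀ {b c} → (b ≡ true → c ≡ true) → bit b ≤ bit c
    bit-mono {false} _ = z≤n
    bit-mono {true}  h rewrite h refl = ≤-refl

  count-mono-≤ : ∀ (p : ℕ → Bool) {m n} → m ≤ n → count p m ≤ count p n
  count-mono-≤ p {m} {zero} z≤n = z≤n
  count-mono-≤ p {m} {suc n} m≤1+n with m ≟ suc n
  ... | yes refl = ≤-refl
  ... | no  m≢1+n = ≤-trans (count-mono-≤ p (m<1+n⇒m≤n (≤∧≢⇒< m≤1+n m≢1+n))) (m≤m+n _ _)

  count-vanish : ∀ (p : ℕ → Bool) {m} n → m ≤ n → (∀ x → m ≤ x → x < n → p x ≡ false) →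
                 count p n ≡ count p m
  count-vanish p zero z≤n h = refl
  count-vanish p {m} (suc n) m≤1+n h with m ≟ suc n
  ... | yes refl = refl
  ... | no  m≢1+n with m<1+n⇒m≤n (≤∧≢⇒< m≤1+n m≢1+n)
  ...   | m≤n rewrite h n m≤n ≤-refl =
    trans (+-identityʳ _) (count-vanish p n m≤n (λ x m≤x x<n → h x m≤x (m<n⇒m<1+n x<n)))

  count-none : ∀ (p : ℕ → Bool) n → (∀ x → x < n → p x ≡ false) → count p n ≡ 0
  count-none p n h = count-vanish p n z≤n (λ x _ → h x)

  count-shift : ∀ (p q : ℕ → Bool) d m → (∀ x → x < d → p x ≡ false) →
                (∀ x → x < m → p (d + x) ≡ q x) → count p (d + m) ≡ count q m
  count-shift p q d zero    h₁ h₂ rewrite +-identityʳ d = count-none p d h₁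
  count-shift p q d (suc m) h₁ h₂ rewrite +-suc d m =
    cong₂ _+_ (count-shift p q d m h₁ (λ x x<m → h₂ x (m<n⇒m<1+n x<m))) (cong bit (h₂ m ≤-refl))

  count-first : ∀ (p : ℕ → Bool) m n → count (λ x → p x ∧ (count p x <ᵇ m)) n ≡ m ⊓ count p n
  count-first p m zero = sym (⊓-zeroʳ m)
  count-first p m (suc n) rewrite count-first p m n with p n | count p n <ᵇ m in eq
  ... | false | _     = trans (+-identityʳ _) (cong (m ⊓_) (sym (+-identityʳ _)))
  ... | true  | true  = begin
      m ⊓ c + 1   ≡⟨ cong (_+ 1) (m≥n⇒m⊓n≡n (<⇒≤ c<m)) ⟩
      c + 1       ≡⟨ sym (m≥n⇒m⊓n≡n (subst (_≤ m) (+-comm 1 c) c<m)) ⟩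
      m ⊓ (c + 1) ∎
    where open ≡-Reasoning
          c   = count p n
          c<m = <ᵇ-sound eq
  ... | true  | false = begin
      m ⊓ c + 0   ≡⟨ +-identityʳ _ ⟩
      m ⊓ c       ≡⟨ m≤n⇒m⊓n≡m m≤c ⟩
      m           ≡⟨ sym (m≤n⇒m⊓n≡m (≤-trans m≤c (m≤m+n c 1))) ⟩
      m ⊓ (c + 1) ∎
    where open ≡-Reasoning
          c   = count p n
          m≤c = <ᵇ-false-sound eq

  count-rest : ∀ (p : ℕ → Bool) m n →
               count (λ x → p x ∧ not (count p x <ᵇ m)) n ≡ count p n ∸ m ⊓ count p n
  count-rest p m n = sym (trans (cong (_∸ m ⊓ count p n) split) (m+n∸m≡n (m ⊓ count p n) _))
    where
    bit-∧-not : ∀ u v → bit u ≡ bit (u ∧ v) + bit (u ∧ not v)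
    bit-∧-not false v     = refl
    bit-∧-not true  true  = refl
    bit-∧-not true  false = refl
    split : count p n ≡ m ⊓ count p n + count (λ x → p x ∧ not (count p x <ᵇ m)) n
    split = trans (count-split n (λ x _ → bit-∧-not (p x) (count p x <ᵇ m)))
                  (cong (_+ count (λ x → p x ∧ not (count p x <ᵇ m)) n) (count-first p m n))

module BenderKnuthMove where

  open import Data.Bool using (Bool; true; false; _∧_; _∨_; not; if_then_else_)
  open import Data.Nat
  open import Data.Nat.Properties
  open import Data.Integer as ℤ using (ℤ)
  open import Data.Integer.Properties using () renaming (suc-pred to ℤsuc-pred; pred-suc to ℤpred-suc)
  open import Data.Product using (_×_; _,_; proj₁; proj₂)
  open import Data.Sum using (_⊎_; inj₁; inj₂)
  open import Data.Empty using (⊥; ⊥-elim)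
  open import Relation.Binary.PropositionalEquality
  open import Relation.Nullary using (yes; no)
  open BoolReflection
  open Counting

  S P : ℤ → ℤ
  S = ℤ.suc
  P = ℤ.pred

  -- Row i ∈ ℤ consists of the cells 0 … L i - 1, and cell x of row i lies
  -- directly above cell x + δ i of row i + 1.
  record IsSemistandard (L δ : ℤ → ℕ) (Y : ℤ → ℕ → ℕ) : Set where
    field
      row-end       : ∀ i → L (S i) ≤ δ i + L i
      row-mono      : ∀ i x → suc x < L i → Y i x ≤ Y i (suc x)
      column-strict : ∀ i x → x < L i → x + δ i < L (S i) → Y i x < Y (S i) (x + δ i)

  module BenderKnuth (L δ : ℤ → ℕ) (Y : ℤ → ℕ → ℕ) (a : ℕ) where

    b : ℕ
    b = suc a

    is-a is-b paired↓ paired↑ free free-a free-b : ℤ → ℕ → Bool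
    is-a i x    = Y i x ≡ᵇ a
    is-b i x    = Y i x ≡ᵇ b
    paired↓ i x = is-a i x ∧ ((x + δ i <ᵇ L (S i)) ∧ (Y (S i) (x + δ i) ≡ᵇ b))
    paired↑ i x = is-b i x ∧ ((δ (P i) ≤ᵇ x) ∧ ((x ∸ δ (P i) <ᵇ L (P i)) ∧ (Y (P i) (x ∸ δ (P i)) ≡ᵇ a)))
    free i x    = (x <ᵇ L i) ∧ ((is-a i x ∧ not (paired↓ i x)) ∨ (is-b i x ∧ not (paired↑ i x)))
    free-a i x  = free i x ∧ is-a i x
    free-b i x  = free i x ∧ is-b i x

    #free-b : ℤ → ℕ
    #free-b i = count (free-b i) (L i)

    #free< : ℤ → ℕ → ℕ
    #free< i x = count (free i) x

    bk : ℤ → ℕ → ℕ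
    bk i x = if free i x then (if #free< i x <ᵇ #free-b i then a else b) else Y i x

    a≢b : a ≢ b
    a≢b ()

    b≢a : b ≢ a
    b≢a ()

    a⊎b⇒≤b : ∀ {v} → v ≡ a ⊎ v ≡ b → v ≤ b
    a⊎b⇒≤b (inj₁ refl) = n≤1+n a
    a⊎b⇒≤b (inj₂ refl) = ≤-refl

    a⊎b⇒a≤ : ∀ {v} → v ≡ a ⊎ v ≡ b → a ≤ v
    a⊎b⇒a≤ (inj₁ refl) = ≤-refl
    a⊎b⇒a≤ (inj₂ refl) = n≤1+n a

    paired↓⁻ : ∀ i x → paired↓ i x ≡ true → Y i x ≡ a × x + δ i < L (S i) × Y (S i) (x + δ i) ≡ b
    paired↓⁻ i x p with ∧-true⁻ {is-a i x} p
    ... | ya , rest with ∧-true⁻ {x + δ i <ᵇ L (S i)} rest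
    ...   | below , yb = ≡ᵇ-sound ya , <ᵇ-sound below , ≡ᵇ-sound yb

    paired↓⁺ : ∀ i x → Y i x ≡ a → x + δ i < L (S i) → Y (S i) (x + δ i) ≡ b → paired↓ i x ≡ true
    paired↓⁺ i x ya below yb = ∧-true⁺ (≡ᵇ-complete ya) (∧-true⁺ (<ᵇ-complete below) (≡ᵇ-complete yb))

    paired↑⁻ : ∀ i x → paired↑ i x ≡ true →
               Y i x ≡ b × δ (P i) ≤ x × x ∸ δ (P i) < L (P i) × Y (P i) (x ∸ δ (P i)) ≡ a
    paired↑⁻ i x p with ∧-true⁻ {is-b i x} p
    ... | yb , rest with ∧-true⁻ {δ (P i) ≤ᵇ x} rest
    ...   | δ≤x , rest′ with ∧-true⁻ {x ∸ δ (P i) <ᵇ L (P i)} rest′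
    ...     | above , ya = ≡ᵇ-sound yb , ≤ᵇ-sound δ≤x , <ᵇ-sound above , ≡ᵇ-sound ya

    paired↑⁺ : ∀ i x → Y i x ≡ b → δ (P i) ≤ x → x ∸ δ (P i) < L (P i) → Y (P i) (x ∸ δ (P i)) ≡ a →
               paired↑ i x ≡ true
    paired↑⁺ i x yb δ≤x above ya =
      ∧-true⁺ (≡ᵇ-complete yb) (∧-true⁺ (≤ᵇ-complete δ≤x) (∧-true⁺ (<ᵇ-complete above) (≡ᵇ-complete ya)))

    data FreeView (i : ℤ) (x : ℕ) : Set where
      view-a : Y i x ≡ a → paired↓ i x ≡ false → FreeView i x
      view-b : Y i x ≡ b → paired↑ i x ≡ false → FreeView i x

    free⁻ : ∀ i x → free i x ≡ true → x < L i × FreeView i x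
    free⁻ i x f with guarded-choice⁻ (x <ᵇ L i) (is-a i x) (paired↓ i x) (is-b i x) (paired↑ i x) f
    ... | x<L , inj₁ (ya , unpaired) = <ᵇ-sound x<L , view-a (≡ᵇ-sound ya) unpaired
    ... | x<L , inj₂ (yb , unpaired) = <ᵇ-sound x<L , view-b (≡ᵇ-sound yb) unpaired

    free⁺-a : ∀ i x → x < L i → Y i x ≡ a → paired↓ i x ≡ false → free i x ≡ true
    free⁺-a i x x<L ya = guarded-choice⁺ˡ (is-b i x) (paired↑ i x) (<ᵇ-complete x<L) (≡ᵇ-complete ya)

    free⁺-b : ∀ i x → x < L i → Y i x ≡ b → paired↑ i x ≡ false → free i x ≡ true
    free⁺-b i x x<L yb = guarded-choice⁺ʳ (is-a i x) (paired↓ i x) (<ᵇ-complete x<L) (≡ᵇ-complete yb)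

    free⇒a⊎b : ∀ i x → free i x ≡ true → Y i x ≡ a ⊎ Y i x ≡ b
    free⇒a⊎b i x f with free⁻ i x f
    ... | _ , view-a ya _ = inj₁ ya
    ... | _ , view-b yb _ = inj₂ yb

    free⇒¬paired↓ : ∀ i x → free i x ≡ true → paired↓ i x ≡ false
    free⇒¬paired↓ i x f with free⁻ i x f
    ... | _ , view-a _ unpaired = unpaired
    ... | _ , view-b yb _       = ≢true⇒≡false (λ p → a≢b (trans (sym (proj₁ (paired↓⁻ i x p))) yb))

    free⇒¬paired↑ : ∀ i x → free i x ≡ true → paired↑ i x ≡ false
    free⇒¬paired↑ i x f with free⁻ i x f
    ... | _ , view-b _ unpaired = unpaired
    ... | _ , view-a ya _       = ≢true⇒≡false (λ p → a≢b (trans (sym ya) (proj₁ (paired↑⁻ i x p))))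

    unfree-a⇒paired↓ : ∀ i x → x < L i → free i x ≡ false → Y i x ≡ a → paired↓ i x ≡ true
    unfree-a⇒paired↓ i x x<L unfree ya =
      ≢false⇒≡true (λ unpaired → true≢false (trans (sym (free⁺-a i x x<L ya unpaired)) unfree))

    unfree-b⇒paired↑ : ∀ i x → x < L i → free i x ≡ false → Y i x ≡ b → paired↑ i x ≡ true
    unfree-b⇒paired↑ i x x<L unfree yb =
      ≢false⇒≡true (λ unpaired → true≢false (trans (sym (free⁺-b i x x<L yb unpaired)) unfree))

    unfree⇒is-a≡paired↓ : ∀ i x → x < L i → free i x ≡ false → is-a i x ≡ paired↓ i x
    unfree⇒is-a≡paired↓ i x x<L unfree = bool-cases (is-a i x)
      (λ ya → trans ya (sym (unfree-a⇒paired↓ i x x<L unfree (≡ᵇ-sound ya))))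
      (λ y≢a → trans y≢a (sym (≢true⇒≡false (λ p → ≡ᵇ-false-sound y≢a (proj₁ (paired↓⁻ i x p))))))

    unfree⇒is-b≡paired↑ : ∀ i x → x < L i → free i x ≡ false → is-b i x ≡ paired↑ i x
    unfree⇒is-b≡paired↑ i x x<L unfree = bool-cases (is-b i x)
      (λ yb → trans yb (sym (unfree-b⇒paired↑ i x x<L unfree (≡ᵇ-sound yb))))
      (λ y≢b → trans y≢b (sym (≢true⇒≡false (λ p → ≡ᵇ-false-sound y≢b (proj₁ (paired↑⁻ i x p))))))

    bk-free : ∀ i x → free i x ≡ true → bk i x ≡ (if #free< i x <ᵇ #free-b i then a else b)
    bk-free i x f rewrite f = refl

    bk-unfree : ∀ i x → free i x ≡ false → bk i x ≡ Y i x
    bk-unfree i x unfree rewrite unfree = refl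

    bk-a⊎b : ∀ i x → free i x ≡ true → bk i x ≡ a ⊎ bk i x ≡ b
    bk-a⊎b i x f rewrite f with #free< i x <ᵇ #free-b i
    ... | true  = inj₁ refl
    ... | false = inj₂ refl

    paired↑-reindex : ∀ (σ : ℤ → ℤ) → (∀ i → P (σ i) ≡ σ (P i)) → (∀ i → L (σ i) ≡ L i) →
                      (∀ i → δ (σ i) ≡ δ i) → (∀ i x → Y (σ i) x ≡ Y i x) → ∀ i x → paired↑ (σ i) x ≡ paired↑ i x
    paired↑-reindex σ hP hL hδ hY i x rewrite hP i | hδ (P i) | hL (P i) | hY i x | hY (P i) (x ∸ δ (P i)) = refl

    paired↑-suc : ∀ i y → paired↑ (S i) y ≡ (is-b (S i) y ∧ ((δ i ≤ᵇ y) ∧ ((y ∸ δ i <ᵇ L i) ∧ (Y i (y ∸ δ i) ≡ᵇ a))))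
    paired↑-suc i y = cong (λ j → is-b (S i) y ∧ ((δ j ≤ᵇ y) ∧ ((y ∸ δ j <ᵇ L j) ∧ (Y j (y ∸ δ j) ≡ᵇ a)))) (ℤpred-suc i)

    paired↓⇒paired↑-below : ∀ i x → x < L i → paired↓ i x ≡ true → paired↑ (S i) (x + δ i) ≡ true
    paired↓⇒paired↑-below i x x<L p with paired↓⁻ i x p
    ... | ya , _ , yb = trans (paired↑-suc i (x + δ i))
      (∧-true⁺ (≡ᵇ-complete yb) (∧-true⁺ (≤ᵇ-complete (m≤n+m (δ i) x))
        (subst (λ z → ((z <ᵇ L i) ∧ (Y i z ≡ᵇ a)) ≡ true) (sym (m+n∸n≡m x (δ i))) (∧-true⁺ (<ᵇ-complete x<L) (≡ᵇ-complete ya)))))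

    module Semistandard (ss : IsSemistandard L δ Y) where
      open IsSemistandard ss

      row-end-pred : ∀ i → L i ≤ δ (P i) + L (P i)
      row-end-pred i = subst (λ j → L j ≤ δ (P i) + L (P i)) (ℤsuc-pred i) (row-end (P i))

      column-strict-pred : ∀ i y → y < L (P i) → y + δ (P i) < L i → Y (P i) y < Y i (y + δ (P i))
      column-strict-pred i y y<L =
        subst (λ j → y + δ (P i) < L j → Y (P i) y < Y j (y + δ (P i))) (ℤsuc-pred i) (column-strict (P i) y y<L)

      row-mono-≤ : ∀ i y x → y ≤ x → x < L i → Y i y ≤ Y i x
      row-mono-≤ i y x y≤x x<L with m≤n⇒∃[o]m+o≡n y≤x
      ... | o , refl = go o x<L
        where
        go : ∀ o → y + o < L i → Y i y ≤ Y i (y + o)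
        go zero    _       rewrite +-identityʳ y = ≤-refl
        go (suc o) y+o+1<L rewrite +-suc y o = ≤-trans (go o (<-trans (n<1+n _) y+o+1<L)) (row-mono i (y + o) y+o+1<L)

      paired↓-prefix : ∀ i x → suc x < L i → Y i x ≡ a → paired↓ i (suc x) ≡ true → paired↓ i x ≡ true
      paired↓-prefix i x 1+x<L ya p with paired↓⁻ i (suc x) p
      ... | _ , below , yb = paired↓⁺ i x ya below′ (≤-antisym upper lower)
        where
        below′ : x + δ i < L (S i)
        below′ = <-trans (n<1+n _) below
        upper : Y (S i) (x + δ i) ≤ b
        upper = subst (Y (S i) (x + δ i) ≤_) yb (row-mono (S i) (x + δ i) below)
        lower : b ≤ Y (S i) (x + δ i)
        lower = subst (λ z → suc z ≤ Y (S i) (x + δ i)) ya (column-strict i x (<-trans (n<1+n _) 1+x<L) below′)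

      paired↑-suffix : ∀ i x → suc x < L i → Y i (suc x) ≡ b → paired↑ i x ≡ true → paired↑ i (suc x) ≡ true
      paired↑-suffix i x 1+x<L yb p with paired↑⁻ i x p
      ... | _ , d≤x , above , ya = paired↑⁺ i (suc x) yb (≤-trans d≤x (n≤1+n x)) above′ (≤-antisym (s≤s⁻¹ upper) lower)
        where
        d = δ (P i)
        shift : suc x ∸ d ≡ suc (x ∸ d)
        shift = +-∸-assoc 1 d≤x
        above′ : suc x ∸ d < L (P i)
        above′ = subst (_< L (P i)) (sym shift)
          (+-cancelˡ-< d (suc (x ∸ d)) (L (P i))
            (subst (_< d + L (P i)) (trans (cong suc (sym (m+[n∸m]≡n d≤x))) (sym (+-suc d (x ∸ d)))) (<-≤-trans 1+x<L (row-end-pred i))))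
        back : suc x ∸ d + d ≡ suc x
        back = m∸n+n≡m (≤-trans d≤x (n≤1+n x))
        lower : a ≤ Y (P i) (suc x ∸ d)
        lower = subst (_≤ Y (P i) (suc x ∸ d)) ya
          (subst (λ z → Y (P i) (x ∸ d) ≤ Y (P i) z) (sym shift) (row-mono (P i) (x ∸ d) (subst (_< L (P i)) shift above′)))
        upper : Y (P i) (suc x ∸ d) < b
        upper = subst (Y (P i) (suc x ∸ d) <_) yb
          (subst (λ z → Y (P i) (suc x ∸ d) < Y i z) back (column-strict-pred i (suc x ∸ d) above′ (subst (_< L i) (sym back) 1+x<L)))

      paired↑⇒paired↓-above : ∀ i x → x < L i → paired↑ i x ≡ true → paired↓ (P i) (x ∸ δ (P i)) ≡ true
      paired↑⇒paired↓-above i x x<L p with paired↑⁻ i x p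
      ... | yb , d≤x , _ , ya = subst (λ j → ((Y (P i) z ≡ᵇ a) ∧ ((z + δ (P i) <ᵇ L j) ∧ (Y j (z + δ (P i)) ≡ᵇ b))) ≡ true)
                                      (sym (ℤsuc-pred i)) (∧-true⁺ (≡ᵇ-complete ya) (∧-true⁺ (<ᵇ-complete z+δ<L) (≡ᵇ-complete yb′)))
        where
        z = x ∸ δ (P i)
        z+δ≡x : z + δ (P i) ≡ x
        z+δ≡x = m∸n+n≡m d≤x
        z+δ<L : z + δ (P i) < L i
        z+δ<L = subst (_< L i) (sym z+δ≡x) x<L
        yb′ : Y i (z + δ (P i)) ≡ b
        yb′ = subst (λ w → Y i w ≡ b) (sym z+δ≡x) yb

      free⇒b<below : ∀ i x → free i x ≡ true → x + δ i < L (S i) → b < Y (S i) (x + δ i)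
      free⇒b<below i x f below with free⁻ i x f
      ... | x<L , view-a ya unpaired = ≤∧≢⇒< (subst (_< Y (S i) (x + δ i)) ya (column-strict i x x<L below))
                                             (λ e → true≢false (trans (sym (paired↓⁺ i x ya below (sym e))) unpaired))
      ... | x<L , view-b yb _        = subst (_< Y (S i) (x + δ i)) yb (column-strict i x x<L below)

      free⇒above<a : ∀ i x → free i x ≡ true → δ (P i) ≤ x → x ∸ δ (P i) < L (P i) → Y (P i) (x ∸ δ (P i)) < a
      free⇒above<a i x f d≤x above = from-view (free⁻ i x f)
        where
        column-above : x < L i → Y (P i) (x ∸ δ (P i)) < Y i x
        column-above x<L = subst (λ w → Y (P i) (x ∸ δ (P i)) < Y i w) (m∸n+n≡m d≤x)
                                 (column-strict-pred i (x ∸ δ (P i)) above (subst (_< L i) (sym (m∸n+n≡m d≤x)) x<L))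
        from-view : x < L i × FreeView i x → Y (P i) (x ∸ δ (P i)) < a
        from-view (x<L , view-a ya _)        = subst (Y (P i) (x ∸ δ (P i)) <_) ya (column-above x<L)
        from-view (x<L , view-b yb unpaired) = ≤∧≢⇒< (s≤s⁻¹ (subst (Y (P i) (x ∸ δ (P i)) <_) yb (column-above x<L)))
                                                     (λ e → true≢false (trans (sym (paired↑⁺ i x yb d≤x above e)) unpaired))

      bk-row-mono : ∀ i x → suc x < L i → bk i x ≤ bk i (suc x)
      bk-row-mono i x 1+x<L =
        bool-cases (free i x) (λ f → bool-cases (free i (suc x)) (both-free f) (free-fixed f))
                              (λ u → bool-cases (free i (suc x)) (fixed-free u) (both-fixed u))
        where
        x<L = <-trans (n<1+n x) 1+x<L
        both-fixed : free i x ≡ false → free i (suc x) ≡ false → bk i x ≤ bk i (suc x)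
        both-fixed u u′ rewrite bk-unfree i x u | bk-unfree i (suc x) u′ = row-mono i x 1+x<L
        both-free : free i x ≡ true → free i (suc x) ≡ true → bk i x ≤ bk i (suc x)
        both-free f f′ = bool-cases (#free< i (suc x) <ᵇ #free-b i) next-a next-b
          where
          next-a : (#free< i (suc x) <ᵇ #free-b i) ≡ true → bk i x ≤ bk i (suc x)
          next-a lt = subst₂ _≤_ (sym bk-x) (sym bk-1+x) ≤-refl
            where
            #free<-suc : #free< i (suc x) ≡ suc (#free< i x)
            #free<-suc = trans (cong (λ z → count (free i) x + bit z) f) (+-comm _ 1)
            bk-1+x : bk i (suc x) ≡ a
            bk-1+x = trans (bk-free i (suc x) f′) (cong (if_then a else b) lt)
            bk-x : bk i x ≡ a
            bk-x = trans (bk-free i x f)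
                         (cong (if_then a else b) (<ᵇ-complete (<-trans (n<1+n _) (subst (_< #free-b i) #free<-suc (<ᵇ-sound lt)))))
          next-b : (#free< i (suc x) <ᵇ #free-b i) ≡ false → bk i x ≤ bk i (suc x)
          next-b nlt = subst (bk i x ≤_) (sym (trans (bk-free i (suc x) f′) (cong (if_then a else b) nlt)))
                             (a⊎b⇒≤b (bk-a⊎b i x f))
        free-fixed : free i x ≡ true → free i (suc x) ≡ false → bk i x ≤ bk i (suc x)
        free-fixed f u′ rewrite bk-unfree i (suc x) u′ =
          ≤-trans (a⊎b⇒≤b (bk-a⊎b i x f)) (≤∧≢⇒< (≤-trans (a⊎b⇒a≤ (free⇒a⊎b i x f)) (row-mono i x 1+x<L)) a≢next)
          where
          a≢next : a ≢ Y i (suc x)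
          a≢next e with free⁻ i x f
          ... | _ , view-a ya unpaired = true≢false (trans (sym (paired↓-prefix i x 1+x<L ya (unfree-a⇒paired↓ i (suc x) 1+x<L u′ (sym e)))) unpaired)
          ... | _ , view-b yb _        = 1+n≰n (subst (_≤ a) yb (subst (Y i x ≤_) (sym e) (row-mono i x 1+x<L)))
        fixed-free : free i x ≡ false → free i (suc x) ≡ true → bk i x ≤ bk i (suc x)
        fixed-free u f′ rewrite bk-unfree i x u =
          ≤-trans (s≤s⁻¹ (≤∧≢⇒< (≤-trans (row-mono i x 1+x<L) (a⊎b⇒≤b (free⇒a⊎b i (suc x) f′))) prev≢b)) (a⊎b⇒a≤ (bk-a⊎b i (suc x) f′))
          where
          prev≢b : Y i x ≢ b
          prev≢b e with free⁻ i (suc x) f′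
          ... | _ , view-a ya _        = 1+n≰n (subst (b ≤_) ya (subst (_≤ Y i (suc x)) e (row-mono i x 1+x<L)))
          ... | _ , view-b yb unpaired = true≢false (trans (sym (paired↑-suffix i x 1+x<L yb (unfree-b⇒paired↑ i x x<L u e))) unpaired)

      bk-column-strict : ∀ i x → x < L i → x + δ i < L (S i) → bk i x < bk (S i) (x + δ i)
      bk-column-strict i x x<L below = bool-cases (free i x) from-free from-fixed
        where
        y = x + δ i
        from-free : free i x ≡ true → bk i x < bk (S i) y
        from-free f = <-≤-trans (s≤s (a⊎b⇒≤b (bk-a⊎b i x f))) (subst (b <_) (sym (bk-unfree (S i) y fixed-below)) b<Y)
          where
          b<Y : b < Y (S i) y
          b<Y = free⇒b<below i x f below
          fixed-below : free (S i) y ≡ false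
          fixed-below = ≢true⇒≡false (λ f′ → <⇒≱ b<Y (a⊎b⇒≤b (free⇒a⊎b (S i) y f′)))
        from-fixed : free i x ≡ false → bk i x < bk (S i) y
        from-fixed u rewrite bk-unfree i x u = bool-cases (free (S i) y) below-free below-fixed
          where
          below-fixed : free (S i) y ≡ false → Y i x < bk (S i) y
          below-fixed u′ rewrite bk-unfree (S i) y u′ = column-strict i x x<L below
          below-free : free (S i) y ≡ true → Y i x < bk (S i) y
          below-free f′ = <-≤-trans (≤∧≢⇒< (s≤s⁻¹ (<-≤-trans (column-strict i x x<L below) (a⊎b⇒≤b (free⇒a⊎b (S i) y f′)))) Y≢a)
                                    (a⊎b⇒a≤ (bk-a⊎b (S i) y f′))
            where
            Y≢a : Y i x ≢ a
            Y≢a ya with free⁻ (S i) y f′ | paired↓⁻ i x (unfree-a⇒paired↓ i x x<L u ya)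
            ... | _ , view-a ya′ _ | _ , _ , yb = a≢b (trans (sym ya′) yb)
            ... | _ , view-b _ unpaired | _  = true≢false (trans (sym (paired↓⇒paired↑-below i x x<L (unfree-a⇒paired↓ i x x<L u ya))) unpaired)

  module Involution (L δ : ℤ → ℕ) (Y : ℤ → ℕ → ℕ) (a : ℕ) (ss : IsSemistandard L δ Y) where
    open BenderKnuth L δ Y a
    open Semistandard ss
    open IsSemistandard ss
    module Image = BenderKnuth L δ bk a

    -- The column neighbours of a free cell are not free, so bk leaves them alone
    -- and no pair is created.
    free⇒free-bk : ∀ i x → x < L i → free i x ≡ true → Image.free i x ≡ true
    free⇒free-bk i x x<L f with bk-a⊎b i x f
    ... | inj₁ bk≡a = Image.free⁺-a i x x<L bk≡a (≢true⇒≡false no-pair)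
      where
      no-pair : Image.paired↓ i x ≢ true
      no-pair p with Image.paired↓⁻ i x p
      ... | _ , below , bk≡b = <-irrefl (sym Y≡b) b<Y
        where
        b<Y = free⇒b<below i x f below
        fixed : free (S i) (x + δ i) ≡ false
        fixed = ≢true⇒≡false (λ f′ → <⇒≱ b<Y (a⊎b⇒≤b (free⇒a⊎b (S i) _ f′)))
        Y≡b : Y (S i) (x + δ i) ≡ b
        Y≡b = trans (sym (bk-unfree (S i) _ fixed)) bk≡b
    ... | inj₂ bk≡b = Image.free⁺-b i x x<L bk≡b (≢true⇒≡false no-pair)
      where
      no-pair : Image.paired↑ i x ≢ true
      no-pair p with Image.paired↑⁻ i x p
      ... | _ , d≤x , above , bk≡a = <-irrefl Y≡a Y<a
        where
        z = x ∸ δ (P i)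
        Y<a = free⇒above<a i x f d≤x above
        fixed : free (P i) z ≡ false
        fixed = ≢true⇒≡false (λ f′ → <⇒≱ Y<a (a⊎b⇒a≤ (free⇒a⊎b (P i) z f′)))
        Y≡a : Y (P i) z ≡ a
        Y≡a = trans (sym (bk-unfree (P i) z fixed)) bk≡a

    -- bk fixes a paired cell and its partner, so the pair survives.
    unfree⇒unfree-bk : ∀ i x → x < L i → free i x ≡ false → Image.free i x ≡ false
    unfree⇒unfree-bk i x x<L u = ≢true⇒≡false no-longer-free
      where
      no-longer-free : Image.free i x ≢ true
      no-longer-free f′ with Image.free⁻ i x f′
      ... | _ , Image.view-a bk≡a unpaired = true≢false (trans (sym (Image.paired↓⁺ i x bk≡a below bk-below≡b)) unpaired)
        where
        ya = trans (sym (bk-unfree i x u)) bk≡a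
        p = unfree-a⇒paired↓ i x x<L u ya
        below = proj₁ (proj₂ (paired↓⁻ i x p))
        yb = proj₂ (proj₂ (paired↓⁻ i x p))
        fixed-below : free (S i) (x + δ i) ≡ false
        fixed-below = ≢true⇒≡false λ f″ → case-view (free⁻ (S i) _ f″)
          where
          case-view : x + δ i < L (S i) × FreeView (S i) (x + δ i) → ⊥
          case-view (_ , view-a ya′ _)       = a≢b (trans (sym ya′) yb)
          case-view (_ , view-b _ unpaired′) = true≢false (trans (sym (paired↓⇒paired↑-below i x x<L p)) unpaired′)
        bk-below≡b : bk (S i) (x + δ i) ≡ b
        bk-below≡b = trans (bk-unfree (S i) _ fixed-below) yb
      ... | _ , Image.view-b bk≡b unpaired = true≢false (trans (sym (Image.paired↑⁺ i x bk≡b d≤x above bk-above≡a)) unpaired)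
        where
        yb = trans (sym (bk-unfree i x u)) bk≡b
        p = unfree-b⇒paired↑ i x x<L u yb
        d≤x = proj₁ (proj₂ (paired↑⁻ i x p))
        above = proj₁ (proj₂ (proj₂ (paired↑⁻ i x p)))
        ya = proj₂ (proj₂ (proj₂ (paired↑⁻ i x p)))
        z = x ∸ δ (P i)
        fixed-above : free (P i) z ≡ false
        fixed-above = ≢true⇒≡false λ f″ → case-view (free⁻ (P i) z f″)
          where
          case-view : z < L (P i) × FreeView (P i) z → ⊥
          case-view (_ , view-a _ unpaired′) = true≢false (trans (sym (paired↑⇒paired↓-above i x x<L p)) unpaired′)
          case-view (_ , view-b yb′ _)       = a≢b (trans (sym ya) yb′)
        bk-above≡a : bk (P i) z ≡ a
        bk-above≡a = trans (bk-unfree (P i) z fixed-above) ya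

    free-bk : ∀ i x → x < L i → Image.free i x ≡ free i x
    free-bk i x x<L = bool-cases (free i x) (λ f → trans (free⇒free-bk i x x<L f) (sym f))
                                            (λ u → trans (unfree⇒unfree-bk i x x<L u) (sym u))

    #free-a : ℤ → ℕ
    #free-a i = count (free-a i) (L i)

    #free≡#free-a+#free-b : ∀ i → count (free i) (L i) ≡ #free-a i + #free-b i
    #free≡#free-a+#free-b i = count-split (L i) pointwise
      where
      pointwise : ∀ x → x < L i → bit (free i x) ≡ bit (free i x ∧ is-a i x) + bit (free i x ∧ is-b i x)
      pointwise x _ with free i x in f
      ... | false = refl
      ... | true with free⇒a⊎b i x f
      ...   | inj₁ ya rewrite ya | ≡ᵇ-refl a | ≡ᵇ-false a≢b = refl
      ...   | inj₂ yb rewrite yb | ≡ᵇ-refl b | ≡ᵇ-false b≢a = refl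

    #free-b≤#free : ∀ i → #free-b i ≤ count (free i) (L i)
    #free-b≤#free i = count-mono-⊆ (L i) (λ x _ fb → proj₁ (∧-true⁻ {free i x} fb))

    -- The first #free-b free cells become a, so the remaining #free-a become b.
    #free-rest : ∀ i → count (λ x → free i x ∧ not (#free< i x <ᵇ #free-b i)) (L i) ≡ #free-a i
    #free-rest i = begin
      count (λ x → free i x ∧ not (#free< i x <ᵇ #free-b i)) (L i) ≡⟨ count-rest (free i) (#free-b i) (L i) ⟩
      count (free i) (L i) ∸ #free-b i ⊓ count (free i) (L i)     ≡⟨ cong (count (free i) (L i) ∸_) (m≤n⇒m⊓n≡m (#free-b≤#free i)) ⟩
      count (free i) (L i) ∸ #free-b i                              ≡⟨ cong (_∸ #free-b i) (#free≡#free-a+#free-b i) ⟩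
      #free-a i + #free-b i ∸ #free-b i                             ≡⟨ m+n∸n≡m (#free-a i) (#free-b i) ⟩
      #free-a i                                                     ∎
      where open ≡-Reasoning

    #free-first : ∀ i → count (λ x → free i x ∧ (#free< i x <ᵇ #free-b i)) (L i) ≡ #free-b i
    #free-first i = trans (count-first (free i) (#free-b i) (L i)) (m≤n⇒m⊓n≡m (#free-b≤#free i))

    if-a-b≡ᵇa : ∀ c → ((if c then a else b) ≡ᵇ a) ≡ c
    if-a-b≡ᵇa true  = ≡ᵇ-refl a
    if-a-b≡ᵇa false = ≡ᵇ-false b≢a

    if-a-b≡ᵇb : ∀ c → ((if c then a else b) ≡ᵇ b) ≡ not c
    if-a-b≡ᵇb true  = ≡ᵇ-false a≢b
    if-a-b≡ᵇb false = ≡ᵇ-refl b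

    #free-b-bk : ∀ i → Image.#free-b i ≡ #free-a i
    #free-b-bk i = trans (count-cong (L i) pointwise) (#free-rest i)
      where
      pointwise : ∀ y → y < L i → Image.free-b i y ≡ (free i y ∧ not (#free< i y <ᵇ #free-b i))
      pointwise y y<L rewrite free-bk i y y<L with free i y in f
      ... | false = refl
      ... | true  = if-a-b≡ᵇb (#free< i y <ᵇ #free-b i)

    free-a⇒#free<<#free-a : ∀ i x → free i x ≡ true → Y i x ≡ a → #free< i x < #free-a i
    free-a⇒#free<<#free-a i x f ya =
      <-≤-trans (subst (_< count (free-a i) (suc x)) (sym only-a-before) one-more) (count-mono-≤ (free-a i) (proj₁ (free⁻ i x f)))
      where
      only-a-before : #free< i x ≡ count (free-a i) x
      only-a-before = count-cong x pointwise
        where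
        pointwise : ∀ y → y < x → free i y ≡ free-a i y
        pointwise y y<x = bool-cases (free i y) at-free (λ u → trans u (sym (∧-falseˡ _ u)))
          where
          at-free : free i y ≡ true → free i y ≡ free-a i y
          at-free f′ with free⇒a⊎b i y f′
          ... | inj₁ ya′ = trans f′ (sym (∧-true⁺ {free i y} {is-a i y} f′ (≡ᵇ-complete ya′)))
          ... | inj₂ yb′ = ⊥-elim (1+n≰n (subst₂ _≤_ yb′ ya (row-mono-≤ i y x (<⇒≤ y<x) (proj₁ (free⁻ i x f)))))
      one-more : count (free-a i) x < count (free-a i) (suc x)
      one-more rewrite ∧-true⁺ {free i x} {is-a i x} f (≡ᵇ-complete ya) = subst (count (free-a i) x <_) (+-comm 1 _) ≤-refl

    free-b⇒#free-a≤#free< : ∀ i x → free i x ≡ true → Y i x ≡ b → #free-a i ≤ #free< i x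
    free-b⇒#free-a≤#free< i x f yb =
      subst (_≤ #free< i x) (sym no-a-after) (count-mono-⊆ x (λ y _ fa → proj₁ (∧-true⁻ {free i y} fa)))
      where
      no-a-after : #free-a i ≡ count (free-a i) x
      no-a-after = count-vanish (free-a i) (L i) (<⇒≤ (proj₁ (free⁻ i x f))) not-a
        where
        not-a : ∀ y → x ≤ y → y < L i → free-a i y ≡ false
        not-a y x≤y y<L = ∧-falseʳ (free i y) (≡ᵇ-false (λ ya → 1+n≰n (subst₂ _≤_ yb ya (row-mono-≤ i x y x≤y y<L))))

    bk-involutive : ∀ i x → x < L i → Image.bk i x ≡ Y i x
    bk-involutive i x x<L = bool-cases (free i x) at-free at-fixed
      where
      at-fixed : free i x ≡ false → Image.bk i x ≡ Y i x
      at-fixed u = trans (Image.bk-unfree i x (trans (free-bk i x x<L) u)) (bk-unfree i x u)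
      at-free : free i x ≡ true → Image.bk i x ≡ Y i x
      at-free f = trans (Image.bk-free i x (trans (free-bk i x x<L) f))
                        (trans (cong₂ (λ u v → if u <ᵇ v then a else b) same-#free< (#free-b-bk i)) (restore (free⇒a⊎b i x f)))
        where
        same-#free< : Image.#free< i x ≡ #free< i x
        same-#free< = count-cong x (λ y y<x → free-bk i y (<-trans y<x x<L))
        restore : Y i x ≡ a ⊎ Y i x ≡ b → (if #free< i x <ᵇ #free-a i then a else b) ≡ Y i x
        restore (inj₁ ya) rewrite <ᵇ-complete (free-a⇒#free<<#free-a i x f ya) = sym ya
        restore (inj₂ yb) with #free< i x <ᵇ #free-a i in lt
        ... | true  = ⊥-elim (<⇒≱ (<ᵇ-sound lt) (free-b⇒#free-a≤#free< i x f yb))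
        ... | false = sym yb

    #value : (ℤ → ℕ → ℕ) → ℤ → ℕ → ℕ
    #value V i v = count (λ x → V i x ≡ᵇ v) (L i)

    #a : ∀ i → #value Y i a ≡ count (paired↓ i) (L i) + #free-a i
    #a i = count-split (L i) pointwise
      where
      pointwise : ∀ x → x < L i → bit (is-a i x) ≡ bit (paired↓ i x) + bit (free i x ∧ is-a i x)
      pointwise x x<L with free i x in f
      ... | true  rewrite free⇒¬paired↓ i x f = refl
      ... | false = trans (cong bit (unfree⇒is-a≡paired↓ i x x<L f)) (sym (+-identityʳ _))

    #b : ∀ i → #value Y i b ≡ count (paired↑ i) (L i) + #free-b i
    #b i = count-split (L i) pointwise
      where
      pointwise : ∀ x → x < L i → bit (is-b i x) ≡ bit (paired↑ i x) + bit (free i x ∧ is-b i x)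
      pointwise x x<L with free i x in f
      ... | true  rewrite free⇒¬paired↑ i x f = refl
      ... | false = trans (cong bit (unfree⇒is-b≡paired↑ i x x<L f)) (sym (+-identityʳ _))

    #a-bk : ∀ i → #value bk i a ≡ count (paired↓ i) (L i) + #free-b i
    #a-bk i = trans (count-split (L i) pointwise) (cong (count (paired↓ i) (L i) +_) (#free-first i))
      where
      pointwise : ∀ x → x < L i → bit (bk i x ≡ᵇ a) ≡ bit (paired↓ i x) + bit (free i x ∧ (#free< i x <ᵇ #free-b i))
      pointwise x x<L with free i x in f
      ... | true  rewrite free⇒¬paired↓ i x f = cong bit (if-a-b≡ᵇa _)
      ... | false = trans (cong bit (unfree⇒is-a≡paired↓ i x x<L f)) (sym (+-identityʳ _))

    #b-bk : ∀ i → #value bk i b ≡ count (paired↑ i) (L i) + #free-a i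
    #b-bk i = trans (count-split (L i) pointwise) (cong (count (paired↑ i) (L i) +_) (#free-rest i))
      where
      pointwise : ∀ x → x < L i → bit (bk i x ≡ᵇ b) ≡ bit (paired↑ i x) + bit (free i x ∧ not (#free< i x <ᵇ #free-b i))
      pointwise x x<L with free i x in f
      ... | true  rewrite free⇒¬paired↑ i x f = cong bit (if-a-b≡ᵇb _)
      ... | false = trans (cong bit (unfree⇒is-b≡paired↑ i x x<L f)) (sym (+-identityʳ _))

    #other-bk : ∀ i v → v ≢ a → v ≢ b → #value bk i v ≡ #value Y i v
    #other-bk i v v≢a v≢b = count-cong (L i) pointwise
      where
      not-v : ∀ {w} → w ≡ a ⊎ w ≡ b → (w ≡ᵇ v) ≡ false
      not-v (inj₁ refl) = ≡ᵇ-false (λ e → v≢a (sym e))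
      not-v (inj₂ refl) = ≡ᵇ-false (λ e → v≢b (sym e))
      pointwise : ∀ x → x < L i → (bk i x ≡ᵇ v) ≡ (Y i x ≡ᵇ v)
      pointwise x _ = bool-cases (free i x) (λ f → trans (not-v (bk-a⊎b i x f)) (sym (not-v (free⇒a⊎b i x f))))
                                            (λ u → cong (_≡ᵇ v) (bk-unfree i x u))

    paired↓-outside : ∀ i x → L (S i) ≤ x + δ i → paired↓ i x ≡ false
    paired↓-outside i x L≤x+δ = ≢true⇒≡false (λ p → <⇒≱ (proj₁ (proj₂ (paired↓⁻ i x p))) L≤x+δ)

    paired↑-below-offset : ∀ i y → y < δ i → paired↑ (S i) y ≡ false
    paired↑-below-offset i y y<δ = trans (paired↑-suc i y)
      (∧-falseʳ (is-b (S i) y) (∧-falseˡ _ (≢true⇒≡false (λ δ≤y → <⇒≱ y<δ (≤ᵇ-sound δ≤y)))))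

    -- x ↦ x + δ i matches the cells of row i paired downwards with the cells of
    -- row i + 1 paired upwards.
    #paired↓≡#paired↑-below : ∀ i → count (paired↓ i) (L i) ≡ count (paired↑ (S i)) (L (S i))
    #paired↓≡#paired↑-below i with δ i ≤? L (S i)
    ... | no δ≰L = trans (count-none (paired↓ i) (L i) (λ x _ → paired↓-outside i x (≤-trans (<⇒≤ (≰⇒> δ≰L)) (m≤n+m (δ i) x))))
                         (sym (count-none (paired↑ (S i)) (L (S i)) (λ y y<L → paired↑-below-offset i y (<-trans y<L (≰⇒> δ≰L)))))
    ... | yes δ≤L = begin
        count (paired↓ i) (L i)          ≡⟨ count-vanish (paired↓ i) (L i) M≤L (λ x M≤x _ → paired↓-outside i x (overhang M≤x)) ⟩
        count (paired↓ i) M              ≡⟨ sym (count-shift (paired↑ (S i)) (paired↓ i) d M (paired↑-below-offset i) matched) ⟩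
        count (paired↑ (S i)) (d + M)    ≡⟨ cong (count (paired↑ (S i))) (sym L≡d+M) ⟩
        count (paired↑ (S i)) (L (S i)) ∎
      where
      open ≡-Reasoning
      d = δ i
      M = L (S i) ∸ d
      L≡d+M : L (S i) ≡ d + M
      L≡d+M = sym (m+[n∸m]≡n δ≤L)
      M≤L : M ≤ L i
      M≤L = subst (M ≤_) (m+n∸m≡n d (L i)) (∸-monoˡ-≤ d (row-end i))
      overhang : ∀ {x} → M ≤ x → L (S i) ≤ x + d
      overhang {x} M≤x = subst (_≤ x + d) (sym L≡d+M) (subst (d + M ≤_) (+-comm d x) (+-monoʳ-≤ d M≤x))
      ∧-swap : ∀ u v → u ∧ v ≡ v ∧ (true ∧ u)
      ∧-swap true  true  = refl
      ∧-swap true  false = refl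
      ∧-swap false true  = refl
      ∧-swap false false = refl
      matched : ∀ x → x < M → paired↑ (S i) (d + x) ≡ paired↓ i x
      matched x x<M = trans (paired↑-suc i (d + x))
        (subst (λ z → (is-b (S i) (d + x) ∧ ((d ≤ᵇ d + x) ∧ ((z <ᵇ L i) ∧ (Y i z ≡ᵇ a)))) ≡ paired↓ i x) (sym (m+n∸m≡n d x))
          (trans (cong₂ (λ u v → is-b (S i) (d + x) ∧ (u ∧ (v ∧ (Y i x ≡ᵇ a)))) (≤ᵇ-complete (m≤m+n d x)) (<ᵇ-complete (<-≤-trans x<M M≤L)))
            (trans (cong (λ z → (Y (S i) z ≡ᵇ b) ∧ (Y i x ≡ᵇ a)) (+-comm d x))
              (trans (∧-swap (Y (S i) (x + d) ≡ᵇ b) (Y i x ≡ᵇ a))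
                (cong (λ u → (Y i x ≡ᵇ a) ∧ (u ∧ (Y (S i) (x + d) ≡ᵇ b))) (sym (<ᵇ-complete x+d<L)))))))
        where
        x+d<L : x + d < L (S i)
        x+d<L = subst (x + d <_) (sym L≡d+M) (subst (_< d + M) (+-comm d x) (+-monoʳ-< d x<M))

  -- bk on row i reads only rows i - 1, i and i + 1; BenderKnuthRow is that
  -- dependency made explicit, and agrees with BenderKnuth.bk definitionally.

  module BenderKnuthRow (a : ℕ) (L↑ L₀ L↓ δ↑ δ₀ : ℕ) (Y↑ Y₀ Y↓ : ℕ → ℕ) where
    b : ℕ
    b = suc a
    is-a is-b paired↓ paired↑ free free-b : ℕ → Bool
    is-a x = Y₀ x ≡ᵇ a
    is-b x = Y₀ x ≡ᵇ b
    paired↓ x = is-a x ∧ ((x + δ₀ <ᵇ L↓) ∧ (Y↓ (x + δ₀) ≡ᵇ b))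
    paired↑ x = is-b x ∧ ((δ↑ ≤ᵇ x) ∧ ((x ∸ δ↑ <ᵇ L↑) ∧ (Y↑ (x ∸ δ↑) ≡ᵇ a)))
    free x = (x <ᵇ L₀) ∧ ((is-a x ∧ not (paired↓ x)) ∨ (is-b x ∧ not (paired↑ x)))
    free-b x = free x ∧ is-b x
    bk : ℕ → ℕ
    bk x = if free x then (if count free x <ᵇ count free-b L₀ then a else b) else Y₀ x

  row-bk-cong : ∀ a L↑ L₀ L↓ δ↑ δ₀ (Y↑ Y₀ Y↓ Y↑′ Y₀′ Y↓′ : ℕ → ℕ) →
                (∀ x → x < L↑ → Y↑ x ≡ Y↑′ x) → (∀ x → x < L₀ → Y₀ x ≡ Y₀′ x) → (∀ x → x < L↓ → Y↓ x ≡ Y↓′ x) →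
                ∀ x → x < L₀ → BenderKnuthRow.bk a L↑ L₀ L↓ δ↑ δ₀ Y↑ Y₀ Y↓ x ≡ BenderKnuthRow.bk a L↑ L₀ L↓ δ↑ δ₀ Y↑′ Y₀′ Y↓′ x
  row-bk-cong a L↑ L₀ L↓ δ↑ δ₀ Y↑ Y₀ Y↓ Y↑′ Y₀′ Y↓′ same↑ same₀ same↓ x x<L =
    trans (cong₂ (λ u v → if u then v else Y₀ x) (free-cong x)
                 (cong₂ (λ u v → if u <ᵇ v then a else suc a) (count-cong x (λ y _ → free-cong y)) (count-cong L₀ (λ y _ → free-b-cong y))))
          (cong (if M′.free x then _ else_) (same₀ x x<L))
    where
    module M  = BenderKnuthRow a L↑ L₀ L↓ δ↑ δ₀ Y↑ Y₀ Y↓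
    module M′ = BenderKnuthRow a L↑ L₀ L↓ δ↑ δ₀ Y↑′ Y₀′ Y↓′
    guarded : ∀ c {u v} → (c ≡ true → u ≡ v) → c ∧ u ≡ c ∧ v
    guarded true  h = h refl
    guarded false h = refl
    paired↓-cong : ∀ y → y < L₀ → M.paired↓ y ≡ M′.paired↓ y
    paired↓-cong y y<L = cong₂ (λ u w → (u ≡ᵇ a) ∧ w) (same₀ y y<L)
                               (guarded (y + δ₀ <ᵇ L↓) (λ below → cong (_≡ᵇ suc a) (same↓ _ (<ᵇ-sound below))))
    paired↑-cong : ∀ y → y < L₀ → M.paired↑ y ≡ M′.paired↑ y
    paired↑-cong y y<L = cong₂ (λ u w → (u ≡ᵇ suc a) ∧ ((δ↑ ≤ᵇ y) ∧ w)) (same₀ y y<L)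
                               (guarded (y ∸ δ↑ <ᵇ L↑) (λ above → cong (_≡ᵇ a) (same↑ _ (<ᵇ-sound above))))
    free-cong : ∀ y → M.free y ≡ M′.free y
    free-cong y = guarded (y <ᵇ L₀) λ y<L →
      trans (cong₂ (λ u v → ((u ≡ᵇ a) ∧ not v) ∨ ((u ≡ᵇ suc a) ∧ not (M.paired↑ y))) (same₀ y (<ᵇ-sound y<L)) (paired↓-cong y (<ᵇ-sound y<L)))
            (cong (λ v → ((Y₀′ y ≡ᵇ a) ∧ not (M′.paired↓ y)) ∨ ((Y₀′ y ≡ᵇ suc a) ∧ not v)) (paired↑-cong y (<ᵇ-sound y<L)))
    free-b-cong : ∀ y → M.free-b y ≡ M′.free-b y
    free-b-cong y = bool-cases (M.free y)
      (λ f → cong₂ _∧_ (free-cong y) (cong (_≡ᵇ suc a) (same₀ y (<ᵇ-sound (proj₁ (∧-true⁻ {y <ᵇ L₀} f))))))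
      (λ u → trans (cong (_∧ M.is-b y) u) (sym (cong (_∧ M′.is-b y) (trans (sym (free-cong y)) u))))

  bk-cong : ∀ (L δ : ℤ → ℕ) (Y Y′ : ℤ → ℕ → ℕ) a → (∀ i x → x < L i → Y i x ≡ Y′ i x) →
            ∀ i x → x < L i → BenderKnuth.bk L δ Y a i x ≡ BenderKnuth.bk L δ Y′ a i x
  bk-cong L δ Y Y′ a same i x x<L =
    row-bk-cong a (L (P i)) (L i) (L (S i)) (δ (P i)) (δ i) (Y (P i)) (Y i) (Y (S i)) (Y′ (P i)) (Y′ i) (Y′ (S i))
      (same (P i)) (same i) (same (S i)) x x<L

  bk-reindex : ∀ (L δ : ℤ → ℕ) (Y : ℤ → ℕ → ℕ) a (σ : ℤ → ℤ) →
               (∀ i → S (σ i) ≡ σ (S i)) → (∀ i → P (σ i) ≡ σ (P i)) →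
               (∀ i → L (σ i) ≡ L i) → (∀ i → δ (σ i) ≡ δ i) → (∀ i x → Y (σ i) x ≡ Y i x) →
               ∀ i x → x < L i → BenderKnuth.bk L δ Y a (σ i) x ≡ BenderKnuth.bk L δ Y a i x
  bk-reindex L δ Y a σ hS hP hL hδ hY i x x<L
    rewrite hS i | hP i | hL (S i) | hL i | hL (P i) | hδ (P i) | hδ i =
    row-bk-cong a (L (P i)) (L i) (L (S i)) (δ (P i)) (δ i) (Y (σ (P i))) (Y (σ i)) (Y (σ (S i))) (Y (P i)) (Y i) (Y (S i))
      (λ y _ → hY (P i) y) (λ y _ → hY i y) (λ y _ → hY (S i) y) x x<L


module FloorDivision (k : ℕ) .{{_ : NonZero k}} where

  import Data.Nat as ℕ
  open import Data.Integer as ℤ using (ℤ; +_; _/ℕ_; _%ℕ_; _+_; _*_; 0ℤ)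
  open import Data.Integer.Properties as ℤP using (+-0-abelianGroup)
  open import Data.Integer.DivMod using (a≡a%ℕn+[a/ℕn]*n; n%ℕd<d; [n/ℕd]*d≤n; n<s[n/ℕd]*d)
  open import Data.Integer.Tactic.RingSolver using (solve-∀)
  open import Algebra.Bundles using (AbelianGroup)
  open import Algebra.Properties.Group (AbelianGroup.group +-0-abelianGroup) using (∙-cancelʳ)
  open import Data.Empty using (⊥-elim)
  open import Data.Product using (_×_; _,_)
  open import Relation.Binary.PropositionalEquality
  open import Relation.Nullary using (yes; no)

  quotient-≤ : ∀ t q q′ → q * + k ℤ.≤ t → t ℤ.< ℤ.suc q′ * + k → q ℤ.≤ q′
  quotient-≤ t q q′ qk≤t t<[q′+1]k with q ℤP.≤? q′
  ... | yes q≤q′ = q≤q′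
  ... | no  q≰q′ = ⊥-elim (ℤP.<-irrefl refl (ℤP.<-≤-trans t<[q′+1]k (ℤP.≤-trans (ℤP.*-monoʳ-≤-nonNeg (+ k) (ℤP.i<j⇒suc[i]≤j (ℤP.≰⇒> q≰q′))) qk≤t)))

  divMod-unique : ∀ t q ρ → ρ ℕ.< k → t ≡ + ρ + q * + k → t /ℕ k ≡ q × t %ℕ k ≡ ρ
  divMod-unique t q ρ ρ<k t≡ρ+qk = q≡ , ℤP.+-injective (∙-cancelʳ ((t /ℕ k) * + k) (+ (t %ℕ k)) (+ ρ) ρ-eq)
    where
    qk≤t : q * + k ℤ.≤ t
    qk≤t = subst (q * + k ℤ.≤_) (sym t≡ρ+qk) (ℤP.i≤j+i (q * + k) (+ ρ))
    t<[q+1]k : t ℤ.< ℤ.suc q * + k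
    t<[q+1]k = subst (ℤ._< ℤ.suc q * + k) (sym t≡ρ+qk)
                 (subst (+ ρ + q * + k ℤ.<_) (sym (ℤP.suc-* q (+ k))) (ℤP.+-monoˡ-< (q * + k) (ℤ.+<+ ρ<k)))
    q≡ : t /ℕ k ≡ q
    q≡ = ℤP.≤-antisym (quotient-≤ t (t /ℕ k) q ([n/ℕd]*d≤n t k) t<[q+1]k)
                      (quotient-≤ t q (t /ℕ k) qk≤t (n<s[n/ℕd]*d t k))
    ρ-eq : + (t %ℕ k) + (t /ℕ k) * + k ≡ + ρ + (t /ℕ k) * + k
    ρ-eq = trans (sym (a≡a%ℕn+[a/ℕn]*n t k)) (trans t≡ρ+qk (cong (λ z → + ρ + z * + k) (sym q≡)))

  divMod-small : ∀ s → s ℕ.< k → (+ s) /ℕ k ≡ 0ℤ × (+ s) %ℕ k ≡ s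
  divMod-small s s<k = divMod-unique (+ s) 0ℤ s s<k (sym (ℤP.+-identityʳ (+ s)))

  divMod-+-multiple : ∀ t m → (t + m * + k) /ℕ k ≡ t /ℕ k + m × (t + m * + k) %ℕ k ≡ t %ℕ k
  divMod-+-multiple t m = divMod-unique (t + m * + k) (t /ℕ k + m) (t %ℕ k) (n%ℕd<d t k)
    (trans (cong (_+ m * + k) (a≡a%ℕn+[a/ℕn]*n t k)) (regroup (+ (t %ℕ k)) (t /ℕ k) m (+ k)))
    where
    regroup : ∀ r q m k → r + q * k + m * k ≡ r + (q + m) * k
    regroup = solve-∀

module ListCounting where

  open import Data.Bool using (Bool; true; false)
  open import Data.Nat as ℕ using (ℕ; zero; suc; _≤_; _+_)
  open import Data.Nat.Properties as ℕP using (≤-antisym)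
  open import Data.List using (List; []; _∷_; _++_; map; concatMap; length; filterᵇ; applyUpTo)
  open import Data.List.Properties using (length-++)
  open import Data.List.Membership.Propositional using (_∈_)
  open import Data.List.Membership.Propositional.Properties
    using (∈-concat⁺′; ∈-concat⁻′; ∈-map⁺; ∈-map⁻; ∈-filter⁺; ∈-filter⁻; ∈-∃++)
  open import Data.List.Relation.Unary.Any using (here; there)
  import Data.List.Relation.Unary.All as All
  open import Data.List.Relation.Unary.Unique.Propositional using (Unique; []; _∷_)
  import Data.List.Relation.Unary.Unique.Propositional.Properties as Unique
  open import Data.Product using (_×_; _,_; proj₂; ∃)
  open import Data.Empty using (⊥-elim)
  open import Relation.Binary.PropositionalEquality
  open import Relation.Nullary using (¬_)
  open import Relation.Nullary.Decidable using (T?)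
  open import Defs using (allᵇ; countᵇ)
  open BoolReflection
  open Counting using (bit; count)

  applyUpTo-cong : ∀ {X : Set} {f g : ℕ → X} n → (∀ x → x ℕ.< n → f x ≡ g x) → applyUpTo f n ≡ applyUpTo g n
  applyUpTo-cong zero    h = refl
  applyUpTo-cong (suc n) h = cong₂ _∷_ (h 0 (ℕ.s≤s ℕ.z≤n)) (applyUpTo-cong n (λ x x<n → h (suc x) (ℕ.s≤s x<n)))

  module _ {A B : Set} where

    ∈-concatMap⁺′ : ∀ {f : A → List B} {xs x y} → x ∈ xs → y ∈ f x → y ∈ concatMap f xs
    ∈-concatMap⁺′ {f} x∈ y∈ = ∈-concat⁺′ y∈ (∈-map⁺ f x∈)

    ∈-concatMap⁻′ : ∀ {f : A → List B} xs {y} → y ∈ concatMap f xs → ∃ λ x → x ∈ xs × y ∈ f x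
    ∈-concatMap⁻′ {f} xs y∈ with ∈-concat⁻′ (map f xs) y∈
    ... | ys , y∈ys , ys∈ with ∈-map⁻ f ys∈
    ...   | x , x∈ , refl = x , x∈ , y∈ys

    concatMap-cong-local : ∀ {f g : A → List B} xs → (∀ x → x ∈ xs → f x ≡ g x) →
                           concatMap f xs ≡ concatMap g xs
    concatMap-cong-local []       h = refl
    concatMap-cong-local (x ∷ xs) h = cong₂ _++_ (h x (here refl)) (concatMap-cong-local xs (λ y y∈ → h y (there y∈)))

    Unique-concatMap : ∀ (f : A → List B) xs → Unique xs → (∀ x → x ∈ xs → Unique (f x)) →
                       (∀ x x′ y → x ∈ xs → x′ ∈ xs → y ∈ f x → y ∈ f x′ → x ≡ x′) →
                       Unique (concatMap f xs)
    Unique-concatMap f []       _          _  _ = []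
    Unique-concatMap f (x ∷ xs) (x∉ ∷ uxs) uf disjoint =
      Unique.++⁺ (uf x (here refl))
                 (Unique-concatMap f xs uxs (λ x′ x′∈ → uf x′ (there x′∈))
                                          (λ x₁ x₂ y x₁∈ x₂∈ → disjoint x₁ x₂ y (there x₁∈) (there x₂∈)))
                 apart
      where
      apart : ∀ {y} → ¬ (y ∈ f x × y ∈ concatMap f xs)
      apart (y∈ , y∈′) with ∈-concatMap⁻′ xs y∈′
      ... | x′ , x′∈ , y∈″ = All.lookup x∉ x′∈ (disjoint x x′ _ (here refl) (there x′∈) y∈ y∈″)

  module _ {A : Set} where

    allᵇ⁻ : ∀ (p : A → Bool) xs {x} → allᵇ p xs ≡ true → x ∈ xs → p x ≡ true
    allᵇ⁻ p (y ∷ ys) e x∈ with p y in py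
    allᵇ⁻ p (y ∷ ys) e (here refl) | true = py
    allᵇ⁻ p (y ∷ ys) e (there x∈) | true = allᵇ⁻ p ys e x∈

    allᵇ⁺ : ∀ (p : A → Bool) xs → (∀ x → x ∈ xs → p x ≡ true) → allᵇ p xs ≡ true
    allᵇ⁺ p []       h = refl
    allᵇ⁺ p (y ∷ ys) h rewrite h y (here refl) = allᵇ⁺ p ys (λ x x∈ → h x (there x∈))

    countᵇ-∷ : ∀ (p : A → Bool) x xs → countᵇ p (x ∷ xs) ≡ bit (p x) + countᵇ p xs
    countᵇ-∷ p x xs with p x
    ... | true  = refl
    ... | false = refl

    countᵇ-++ : ∀ (p : A → Bool) xs ys → countᵇ p (xs ++ ys) ≡ countᵇ p xs + countᵇ p ys
    countᵇ-++ p []       ys = refl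
    countᵇ-++ p (x ∷ xs) ys
      rewrite countᵇ-∷ p x (xs ++ ys) | countᵇ-∷ p x xs | countᵇ-++ p xs ys = sym (ℕP.+-assoc (bit (p x)) _ _)

    countᵇ-applyUpTo : ∀ (p : A → Bool) g n → countᵇ p (applyUpTo g n) ≡ count (λ x → p (g x)) n
    countᵇ-applyUpTo p g zero    = refl
    countᵇ-applyUpTo p g (suc n) = begin
      countᵇ p (g 0 ∷ applyUpTo (λ x → g (suc x)) n)            ≡⟨ countᵇ-∷ p (g 0) _ ⟩
      bit (p (g 0)) + countᵇ p (applyUpTo (λ x → g (suc x)) n)  ≡⟨ cong (bit (p (g 0)) +_) (countᵇ-applyUpTo p (λ x → g (suc x)) n) ⟩
      bit (p (g 0)) + count (λ x → p (g (suc x))) n             ≡⟨ count-front (λ x → p (g x)) n ⟩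
      count (λ x → p (g x)) (suc n)                             ∎
      where
      open ≡-Reasoning
      count-front : ∀ q n → bit (q 0) + count (λ x → q (suc x)) n ≡ count q (suc n)
      count-front q zero    = ℕP.+-comm (bit (q 0)) 0
      count-front q (suc n) rewrite sym (count-front q n) = sym (ℕP.+-assoc (bit (q 0)) _ _)

    ∈-filterᵇ⁻ : ∀ (p : A → Bool) {xs x} → x ∈ filterᵇ p xs → x ∈ xs × p x ≡ true
    ∈-filterᵇ⁻ p x∈ with ∈-filter⁻ (λ z → T? (p z)) x∈
    ... | x∈xs , px = x∈xs , T⇒≡true px

    ∈-filterᵇ⁺ : ∀ (p : A → Bool) {xs x} → x ∈ xs → p x ≡ true → x ∈ filterᵇ p xs
    ∈-filterᵇ⁺ p x∈ px = ∈-filter⁺ (λ z → T? (p z)) x∈ (≡true⇒T px)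

    ∈-remove : ∀ {y z : A} zs₁ zs₂ → y ∈ zs₁ ++ z ∷ zs₂ → y ≢ z → y ∈ zs₁ ++ zs₂
    ∈-remove []        zs₂ (here refl) y≢z = ⊥-elim (y≢z refl)
    ∈-remove []        zs₂ (there y∈)  _   = y∈
    ∈-remove (w ∷ zs₁) zs₂ (here refl) _   = here refl
    ∈-remove (w ∷ zs₁) zs₂ (there y∈)  y≢z = there (∈-remove zs₁ zs₂ y∈ y≢z)

    injection⇒length-≤ : ∀ (h : A → A) ys zs → Unique ys → (∀ y → y ∈ ys → h y ∈ zs) →
                         (∀ y y′ → y ∈ ys → y′ ∈ ys → h y ≡ h y′ → y ≡ y′) → length ys ≤ length zs
    injection⇒length-≤ h []       zs _           _    _   = ℕ.z≤n
    injection⇒length-≤ h (y ∷ ys) zs (y∉ ∷ uys) into inj with ∈-∃++ (into y (here refl))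
    ... | zs₁ , zs₂ , refl =
      subst (suc (length ys) ≤_) (sym (trans (length-++ zs₁) (ℕP.+-suc (length zs₁) (length zs₂))))
        (ℕ.s≤s (subst (length ys ≤_) (length-++ zs₁) (injection⇒length-≤ h ys (zs₁ ++ zs₂) uys into′ inj′)))
      where
      into′ : ∀ y′ → y′ ∈ ys → h y′ ∈ zs₁ ++ zs₂
      into′ y′ y′∈ = ∈-remove zs₁ zs₂ (into y′ (there y′∈))
                       (λ e → All.lookup y∉ y′∈ (sym (inj y′ y (there y′∈) (here refl) e)))
      inj′ : ∀ y₁ y₂ → y₁ ∈ ys → y₂ ∈ ys → h y₁ ≡ h y₂ → y₁ ≡ y₂
      inj′ y₁ y₂ y₁∈ y₂∈ = inj y₁ y₂ (there y₁∈) (there y₂∈)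

    countᵇ-≤-by-retraction : ∀ (p q : A → Bool) (f g : A → A) xs → Unique xs →
                             (∀ x → x ∈ xs → p x ≡ true → f x ∈ xs × q (f x) ≡ true × g (f x) ≡ x) →
                             countᵇ p xs ≤ countᵇ q xs
    countᵇ-≤-by-retraction p q f g xs uxs h =
      injection⇒length-≤ f (filterᵇ p xs) (filterᵇ q xs) (Unique.filter⁺ (λ z → T? (p z)) uxs) into inj
      where
      into : ∀ y → y ∈ filterᵇ p xs → f y ∈ filterᵇ q xs
      into y y∈ with ∈-filterᵇ⁻ p y∈
      ... | y∈xs , py with h y y∈xs py
      ...   | fy∈ , qfy , _ = ∈-filterᵇ⁺ q fy∈ qfy
      inj : ∀ y y′ → y ∈ filterᵇ p xs → y′ ∈ filterᵇ p xs → f y ≡ f y′ → y ≡ y′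
      inj y y′ y∈ y′∈ e with ∈-filterᵇ⁻ p y∈ | ∈-filterᵇ⁻ p y′∈
      ... | y∈xs , py | y′∈xs , py′ =
        trans (sym (proj₂ (proj₂ (h y y∈xs py)))) (trans (cong g e) (proj₂ (proj₂ (h y′ y′∈xs py′))))

    countᵇ-bijection : ∀ (p q : A → Bool) (f g : A → A) xs → Unique xs →
                       (∀ x → x ∈ xs → p x ≡ true → f x ∈ xs × q (f x) ≡ true × g (f x) ≡ x) →
                       (∀ x → x ∈ xs → q x ≡ true → g x ∈ xs × p (g x) ≡ true × f (g x) ≡ x) →
                       countᵇ p xs ≡ countᵇ q xs
    countᵇ-bijection p q f g xs uxs f-into g-into =
      ≤-antisym (countᵇ-≤-by-retraction p q f g xs uxs f-into) (countᵇ-≤-by-retraction q p g f xs uxs g-into)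

module FiniteSums where

  open import Data.Bool using (Bool)
  open import Data.Nat using (ℕ; zero; suc; _+_; _<_)
  open import Data.Nat.Properties using (+-comm; +-assoc; ≤-refl; m<n⇒m<1+n)
  open import Data.Nat.Tactic.RingSolver using (solve-∀)
  open import Data.List using (List; _++_; concatMap; applyUpTo)
  open import Relation.Binary.PropositionalEquality
  open import Defs using (countᵇ)
  open ListCounting using (countᵇ-++)

  sumTo : (ℕ → ℕ) → ℕ → ℕ
  sumTo f zero    = 0
  sumTo f (suc n) = sumTo f n + f n

  sumTo-cong : ∀ {f g} n → (∀ x → x < n → f x ≡ g x) → sumTo f n ≡ sumTo g n
  sumTo-cong zero    h = refl
  sumTo-cong (suc n) h = cong₂ _+_ (sumTo-cong n (λ x x<n → h x (m<n⇒m<1+n x<n))) (h n ≤-refl)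

  sumTo-+ : ∀ f g n → sumTo (λ x → f x + g x) n ≡ sumTo f n + sumTo g n
  sumTo-+ f g zero    = refl
  sumTo-+ f g (suc n) rewrite sumTo-+ f g n = interchange (sumTo f n) (sumTo g n) (f n) (g n)
    where
    interchange : ∀ a b c d → a + b + (c + d) ≡ a + c + (b + d)
    interchange = solve-∀

  sumTo-front : ∀ f n → sumTo f (suc n) ≡ f 0 + sumTo (λ x → f (suc x)) n
  sumTo-front f zero                             = +-comm 0 (f 0)
  sumTo-front f (suc n) rewrite sumTo-front f n = +-assoc (f 0) _ _

  sumTo-rotate : ∀ f n → f n ≡ f 0 → sumTo (λ x → f (suc x)) n ≡ sumTo f n
  sumTo-rotate f zero    _      = refl
  sumTo-rotate f (suc n) fn≡f0 = begin
    sumTo (λ x → f (suc x)) n + f (suc n) ≡⟨ cong (sumTo (λ x → f (suc x)) n +_) fn≡f0 ⟩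
    sumTo (λ x → f (suc x)) n + f 0       ≡⟨ +-comm _ (f 0) ⟩
    f 0 + sumTo (λ x → f (suc x)) n       ≡⟨ sym (sumTo-front f n) ⟩
    sumTo f (suc n)                       ∎
    where open ≡-Reasoning

  countᵇ-concatMap : ∀ {A X : Set} (p : A → Bool) (f : X → List A) g m →
                     countᵇ p (concatMap f (applyUpTo g m)) ≡ sumTo (λ s → countᵇ p (f (g s))) m
  countᵇ-concatMap p f g zero    = refl
  countᵇ-concatMap p f g (suc m) = begin
    countᵇ p (f (g 0) ++ concatMap f (applyUpTo (λ x → g (suc x)) m))
      ≡⟨ countᵇ-++ p (f (g 0)) _ ⟩
    countᵇ p (f (g 0)) + countᵇ p (concatMap f (applyUpTo (λ x → g (suc x)) m))
      ≡⟨ cong (countᵇ p (f (g 0)) +_) (countᵇ-concatMap p f (λ x → g (suc x)) m) ⟩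
    countᵇ p (f (g 0)) + sumTo (λ s → countᵇ p (f (g (suc s)))) m
      ≡⟨ sym (sumTo-front (λ s → countᵇ p (f (g s))) m) ⟩
    sumTo (λ s → countᵇ p (f (g s))) (suc m) ∎
    where open ≡-Reasoning

module Fillings where

  open import Data.Bool using (true; false)
  open import Data.Nat as ℕ using (ℕ; zero; suc; _≤_; _≡ᵇ_)
  open import Data.Nat.Properties using (<-irrefl; suc-injective)
  open import Data.Integer as ℤ using (ℤ)
  open import Data.List using ([]; _∷_; map; upTo)
  open import Data.List.Properties using (∷-injectiveˡ; ∷-injectiveʳ; map-∘; map-id-local)
  open import Data.List.Membership.Propositional using (_∈_)
  open import Data.List.Membership.Propositional.Properties using (∈-map⁺; ∈-map⁻; ∈-upTo⁺; ∈-upTo⁻)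
  open import Data.List.Relation.Unary.Any using (here; there)
  import Data.List.Relation.Unary.All as All
  open import Data.List.Relation.Unary.Unique.Propositional using (Unique; []; _∷_)
  import Data.List.Relation.Unary.Unique.Propositional.Properties as Unique
  open import Data.Product using (_×_; _,_; proj₁; proj₂; ∃)
  open import Data.Empty using (⊥-elim)
  open import Relation.Binary.PropositionalEquality
  open import Relation.Nullary using (yes; no)
  open import Defs using (Filling; valueAt; _==ᶜ_; allFillings; listEqᵇ)
  open BoolReflection
  open ListCounting using (∈-concatMap⁺′; ∈-concatMap⁻′; Unique-concatMap)

  ==ᶜ-refl : ∀ c → c ==ᶜ c ≡ true
  ==ᶜ-refl (i , j) with i ℤ.≟ i | j ℤ.≟ j
  ... | yes _ | yes _  = refl
  ... | no i≢i | _     = ⊥-elim (i≢i refl)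
  ... | yes _ | no j≢j = ⊥-elim (j≢j refl)

  ==ᶜ-sound : ∀ c c′ → c ==ᶜ c′ ≡ true → c ≡ c′
  ==ᶜ-sound (i , j) (i′ , j′) e with i ℤ.≟ i′ | j ℤ.≟ j′
  ... | yes refl | yes refl = refl
  ... | no _     | _        = ⊥-elim (true≢false (sym e))
  ... | yes _    | no _     = ⊥-elim (true≢false (sym e))

  valueAt-∈ : ∀ (F : Filling) c v → Unique (map proj₁ F) → (c , v) ∈ F → valueAt F c ≡ v
  valueAt-∈ ((c′ , v′) ∷ F) c v _ (here refl) rewrite ==ᶜ-refl c = refl
  valueAt-∈ ((c′ , v′) ∷ F) c v (c′∉ ∷ u) (there cv∈) with c′ ==ᶜ c in eq
  ... | true  = ⊥-elim (All.lookup c′∉ (∈-map⁺ proj₁ cv∈) (==ᶜ-sound c′ c eq))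
  ... | false = valueAt-∈ F c v u cv∈

  filling-graph : ∀ (F : Filling) → Unique (map proj₁ F) → F ≡ map (λ c → (c , valueAt F c)) (map proj₁ F)
  filling-graph F u =
    trans (sym (map-id-local (All.tabulate (λ {e} e∈ → cong (proj₁ e ,_) (valueAt-∈ F (proj₁ e) (proj₂ e) u e∈)))))
          (map-∘ F)

  allFillings-domain : ∀ l D F → F ∈ allFillings l D → map proj₁ F ≡ D
  allFillings-domain l [] .[] (here refl) = refl
  allFillings-domain l (c ∷ cs) F F∈ with ∈-concatMap⁻′ (upTo l) F∈
  ... | v , _ , F∈′ with ∈-map⁻ ((c , suc v) ∷_) F∈′
  ...   | F′ , F′∈ , refl = cong (c ∷_) (allFillings-domain l cs F′ F′∈)

  allFillings-range : ∀ l D F → F ∈ allFillings l D → ∀ c v → (c , v) ∈ F → 1 ≤ v × v ≤ l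
  allFillings-range l []       .[] (here refl) c v ()
  allFillings-range l (c₀ ∷ cs) F F∈ c v cv∈ with ∈-concatMap⁻′ (upTo l) F∈
  ... | w , w∈ , F∈′ with ∈-map⁻ ((c₀ , suc w) ∷_) F∈′
  ...   | F′ , F′∈ , refl with cv∈
  ...     | here refl  = ℕ.s≤s ℕ.z≤n , ∈-upTo⁻ w∈
  ...     | there cv∈′ = allFillings-range l cs F′ F′∈ c v cv∈′

  allFillings-complete : ∀ l D (F : Filling) → map proj₁ F ≡ D → (∀ c v → (c , v) ∈ F → 1 ≤ v × v ≤ l) →
                         F ∈ allFillings l D
  allFillings-complete l []       []                 refl _ = here refl
  allFillings-complete l (c ∷ cs) ((.c , zero) ∷ F) refl h = ⊥-elim (<-irrefl refl (proj₁ (h c zero (here refl))))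
  allFillings-complete l (c ∷ cs) ((.c , suc v) ∷ F) refl h =
    ∈-concatMap⁺′ (∈-upTo⁺ (proj₂ (h c (suc v) (here refl))))
      (∈-map⁺ ((c , suc v) ∷_) (allFillings-complete l cs F refl (λ c′ v′ cv∈ → h c′ v′ (there cv∈))))

  allFillings-unique : ∀ l D → Unique (allFillings l D)
  allFillings-unique l []       = All.[] ∷ []
  allFillings-unique l (c ∷ cs) =
    Unique-concatMap (λ v → map ((c , suc v) ∷_) (allFillings l cs)) (upTo l) (Unique.upTo⁺ l)
      (λ v _ → Unique.map⁺ ∷-injectiveʳ (allFillings-unique l cs))
      (λ v v′ F _ _ F∈ F∈′ → same-head (∈-map⁻ _ F∈) (∈-map⁻ _ F∈′))
    where
    same-head : ∀ {v v′ F} → (∃ λ G → G ∈ allFillings l cs × F ≡ (c , suc v) ∷ G) →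
                (∃ λ G → G ∈ allFillings l cs × F ≡ (c , suc v′) ∷ G) → v ≡ v′
    same-head (G , _ , refl) (G′ , _ , e) = suc-injective (cong proj₂ (∷-injectiveˡ e))

  listEqᵇ-sound : ∀ xs ys → listEqᵇ xs ys ≡ true → xs ≡ ys
  listEqᵇ-sound []       []       _ = refl
  listEqᵇ-sound (x ∷ xs) (y ∷ ys) e with x ≡ᵇ y in x≡ᵇy
  ... | true = cong₂ _∷_ (≡ᵇ-sound x≡ᵇy) (listEqᵇ-sound xs ys e)

  listEqᵇ-refl : ∀ xs → listEqᵇ xs xs ≡ true
  listEqᵇ-refl []       = refl
  listEqᵇ-refl (x ∷ xs) rewrite ≡ᵇ-refl x = listEqᵇ-refl xs

module Transposition where

  open import Data.Nat using (ℕ; zero; suc)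
  open import Data.Nat.Properties using (suc-injective)
  open import Data.List using (List; []; _∷_; _++_; length; applyUpTo)
  open import Data.List.Properties using (∷-injective)
  open import Data.Product using (_,_)
  open import Relation.Binary.PropositionalEquality

  transposeAt : ℕ → ℕ → ℕ
  transposeAt zero    zero          = 1
  transposeAt zero    (suc zero)    = 0
  transposeAt zero    (suc (suc m)) = suc (suc m)
  transposeAt (suc p) zero          = zero
  transposeAt (suc p) (suc m)       = suc (transposeAt p m)

  data TransposeView (p m : ℕ) : Set where
    at-p    : m ≡ p → transposeAt p m ≡ suc p → TransposeView p m
    at-1+p  : m ≡ suc p → transposeAt p m ≡ p → TransposeView p m
    elsewhere : m ≢ p → m ≢ suc p → transposeAt p m ≡ m → TransposeView p m

  transposeView : ∀ p m → TransposeView p m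
  transposeView zero    zero          = at-p refl refl
  transposeView zero    (suc zero)    = at-1+p refl refl
  transposeView zero    (suc (suc m)) = elsewhere (λ ()) (λ ()) refl
  transposeView (suc p) zero          = elsewhere (λ ()) (λ ()) refl
  transposeView (suc p) (suc m) with transposeView p m
  ... | at-p e₁ e₂          = at-p (cong suc e₁) (cong suc e₂)
  ... | at-1+p e₁ e₂        = at-1+p (cong suc e₁) (cong suc e₂)
  ... | elsewhere m≢p m≢1+p e =
    elsewhere (λ e′ → m≢p (suc-injective e′)) (λ e′ → m≢1+p (suc-injective e′)) (cong suc e)

  applyUpTo-transposeAt : ∀ (f : ℕ → ℕ) l (α : List ℕ) x y γ → applyUpTo f l ≡ α ++ x ∷ y ∷ γ →
                          applyUpTo (λ m → f (transposeAt (length α) m)) l ≡ α ++ y ∷ x ∷ γ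
  applyUpTo-transposeAt f (suc (suc l)) [] x y γ e with ∷-injective e
  ... | f0≡x , e′ with ∷-injective e′
  ...   | f1≡y , rest = cong₂ _∷_ f1≡y (cong₂ _∷_ f0≡x rest)
  applyUpTo-transposeAt f (suc l) (a ∷ α) x y γ e with ∷-injective e
  ... | f0≡a , e′ = cong₂ _∷_ f0≡a (applyUpTo-transposeAt (λ m → f (suc m)) l α x y γ e′)
  applyUpTo-transposeAt f zero       []      x y γ ()
  applyUpTo-transposeAt f (suc zero) []      x y γ ()
  applyUpTo-transposeAt f zero       (a ∷ α) x y γ ()

module IntegerRanges where

  open import Data.Nat as ℕ using (ℕ; zero; suc)
  import Data.Nat.Properties as ℕP
  open import Data.Integer as ℤ using (ℤ; +_; -[1+_]; _+_; _-_; -_; _≤_; 1ℤ; 0ℤ)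
  import Data.Integer.Properties as ℤP
  open import Data.Integer.Tactic.RingSolver using (solve-∀)
  open import Data.List using (_∷_; applyUpTo)
  open import Relation.Binary.PropositionalEquality
  open import Defs using (pos; range)
  open ListCounting using (applyUpTo-cong)

  pos-nonNeg : ∀ z → 0ℤ ≤ z → + pos z ≡ z
  pos-nonNeg (+ m) _ = refl

  pos-mono : ∀ {u v} → u ≤ v → pos u ℕ.≤ pos v
  pos-mono (ℤ.-≤- _)    = ℕ.z≤n
  pos-mono ℤ.-≤+        = ℕ.z≤n
  pos-mono (ℤ.+≤+ m≤n) = m≤n

  pos-+-≤ : ∀ u v → 0ℤ ≤ u → pos (u + v) ℕ.≤ pos u ℕ.+ pos v
  pos-+-≤ (+ m) (+ n)      _ = ℕP.≤-refl
  pos-+-≤ (+ m) -[1+ n ]  _ = ℕP.≤-trans (pos-mono (ℤP.i-j≤i (+ m) (+ suc n))) (ℕP.m≤m+n m 0)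

  range-applyUpTo : ∀ a c → range a c ≡ applyUpTo (λ x → a + + x) c
  range-applyUpTo a zero    = refl
  range-applyUpTo a (suc c) =
    cong₂ _∷_ (sym (ℤP.+-identityʳ a))
              (trans (range-applyUpTo (a + 1ℤ) c) (applyUpTo-cong c (λ x _ → ℤP.+-assoc a 1ℤ (+ x))))

  ≤⇒<width : ∀ a h y → a + 1ℤ + + y ≤ h → y ℕ.< pos (h - a)
  ≤⇒<width a h y a+1+y≤h = pos-mono {+ suc y} (subst (_≤ h - a) (cancel a (+ y)) (ℤP.+-monoˡ-≤ (- a) a+1+y≤h))
    where
    cancel : ∀ a y → a + 1ℤ + y - a ≡ 1ℤ + y
    cancel = solve-∀

  <width⇒≤ : ∀ a h y → y ℕ.< pos (h - a) → a + 1ℤ + + y ≤ h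
  <width⇒≤ a h y = go (h - a) refl
    where
    reassoc : ∀ a y → a + (1ℤ + y) ≡ a + 1ℤ + y
    reassoc = solve-∀
    cancel : ∀ a h → a + (h - a) ≡ h
    cancel = solve-∀
    go : ∀ z → h - a ≡ z → y ℕ.< pos z → a + 1ℤ + + y ≤ h
    go (+ m) e y<m = subst₂ _≤_ (reassoc a (+ y)) (trans (cong (λ z → a + z) (sym e)) (cancel a h)) (ℤP.+-monoʳ-≤ a (ℤ.+≤+ y<m))

module CylinderCoordinates (k n : ℕ) .{{_ : NonZero k}} where

  open import Data.Nat as ℕ using (suc)
  import Data.Nat.Properties as ℕP
  open import Data.Integer as ℤ using (ℤ; +_; _/ℕ_; _%ℕ_; _+_; _*_; _-_; -_; _≤_; 1ℤ; 0ℤ)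
  import Data.Integer.Properties as ℤP
  open import Data.Integer.DivMod using (a≡a%ℕn+[a/ℕn]*n; n%ℕd<d)
  open import Data.Integer.Tactic.RingSolver using (solve-∀)
  open import Data.Fin as Fin using (fromℕ<)
  open import Data.Fin.Properties using (fromℕ<-cong; toℕ-fromℕ<)
  open import Data.Vec using (Vec; lookup)
  open import Data.Product using (_,_; proj₂)
  open import Relation.Binary.PropositionalEquality
  open import Relation.Nullary using (Dec; yes; no)
  open import Defs using (IsPartition; shiftSeq; rep)
  open FloorDivision k

  K M : ℤ
  K = + k
  M = + (n ℕ.∸ k)

  shiftSeq-char : ∀ (lam : Vec ℕ k) r j q ρ (ρ<k : ρ ℕ.< k) → j - r - 1ℤ ≡ + ρ + q * K →
                  shiftSeq k n lam r j ≡ + lookup lam (fromℕ< ρ<k) + r - q * M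
  shiftSeq-char lam r j q ρ ρ<k e with divMod-unique (j - r - 1ℤ) q ρ ρ<k e
  ... | q≡ , ρ≡ = cong₂ (λ u v → + lookup lam u + r - v * M) (fromℕ<-cong _ _ ρ≡ _ _) q≡

  rep-char : ∀ i j q ρ → ρ ℕ.< k → i - 1ℤ ≡ + ρ + q * K → rep k n (i , j) ≡ (+ suc ρ , j + q * M)
  rep-char i j q ρ ρ<k e with divMod-unique (i - 1ℤ) q ρ ρ<k e
  ... | q≡ , ρ≡ = cong₂ (λ u v → (+ suc u , j + v * M)) ρ≡ q≡

  shiftSeq-period : ∀ (lam : Vec ℕ k) r j m → shiftSeq k n lam r (j + m * K) ≡ shiftSeq k n lam r j - m * M
  shiftSeq-period lam r j m =
    trans (shiftSeq-char lam r (j + m * K) (q + m) ρ ρ<k e′)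
          (trans (regroup₂ (+ lookup lam (fromℕ< ρ<k)) r q m M) (cong (_- m * M) (sym (shiftSeq-char lam r j q ρ ρ<k e))))
    where
    t = j - r - 1ℤ
    ρ = t %ℕ k
    q = t /ℕ k
    ρ<k = n%ℕd<d t k
    e = a≡a%ℕn+[a/ℕn]*n t k
    shuffle : ∀ j m K r → j + m * K - r - 1ℤ ≡ (j - r - 1ℤ) + m * K
    shuffle = solve-∀
    regroup₁ : ∀ a q m K → a + q * K + m * K ≡ a + (q + m) * K
    regroup₁ = solve-∀
    regroup₂ : ∀ a r q m X → a + r - (q + m) * X ≡ a + r - q * X - m * X
    regroup₂ = solve-∀
    e′ : j + m * K - r - 1ℤ ≡ + ρ + (q + m) * K
    e′ = trans (shuffle j m K r) (trans (cong (_+ m * K) e) (regroup₁ (+ ρ) q m K))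

  -- Within a block of k consecutive indices this is monotonicity of λ; across
  -- a block boundary it is λ_1 ≤ n - k.
  shiftSeq-antitone : ∀ (lam : Vec ℕ k) → IsPartition k n lam → ∀ r j →
                      shiftSeq k n lam r (ℤ.suc j) ≤ shiftSeq k n lam r j
  shiftSeq-antitone lam (lam-mono , lam-bounded) r j = step (suc ρ ℕP.<? k)
    where
    t = j - r - 1ℤ
    ρ = t %ℕ k
    q = t /ℕ k
    ρ<k = n%ℕd<d t k
    e = a≡a%ℕn+[a/ℕn]*n t k
    step : Dec (suc ρ ℕ.< k) → shiftSeq k n lam r (ℤ.suc j) ≤ shiftSeq k n lam r j
    step (yes 1+ρ<k) = subst₂ _≤_ (sym (shiftSeq-char lam r (ℤ.suc j) q (suc ρ) 1+ρ<k e₁)) (sym (shiftSeq-char lam r j q ρ ρ<k e))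
                         (ℤP.+-monoˡ-≤ (- (q * M)) (ℤP.+-monoˡ-≤ r (ℤ.+≤+ (lam-mono (fromℕ< ρ<k) (fromℕ< 1+ρ<k) ρ≤1+ρ))))
      where
      shuffle : ∀ j r → 1ℤ + j - r - 1ℤ ≡ 1ℤ + (j - r - 1ℤ)
      shuffle = solve-∀
      regroup : ∀ a b → 1ℤ + (a + b) ≡ (1ℤ + a) + b
      regroup = solve-∀
      e₁ : ℤ.suc j - r - 1ℤ ≡ + suc ρ + q * K
      e₁ = trans (shuffle j r) (trans (cong (λ z → 1ℤ + z) e) (regroup (+ ρ) (q * K)))
      ρ≤1+ρ : fromℕ< ρ<k Fin.≤ fromℕ< 1+ρ<k
      ρ≤1+ρ = subst₂ ℕ._≤_ (sym (toℕ-fromℕ< ρ<k)) (sym (toℕ-fromℕ< 1+ρ<k)) (ℕP.n≤1+n ρ)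
    step (no 1+ρ≮k) = subst₂ _≤_ (sym (shiftSeq-char lam r (ℤ.suc j) (q + 1ℤ) 0 0<k e₁)) (sym (shiftSeq-char lam r j q ρ ρ<k e)) across
      where
      1+ρ≡k : suc ρ ≡ k
      1+ρ≡k = ℕP.≤-antisym ρ<k (ℕP.≮⇒≥ 1+ρ≮k)
      0<k : 0 ℕ.< k
      0<k = ℕP.<-≤-trans (ℕ.s≤s ℕ.z≤n) ρ<k
      shuffle : ∀ j r → 1ℤ + j - r - 1ℤ ≡ (j - r - 1ℤ) + 1ℤ
      shuffle = solve-∀
      regroup₁ : ∀ ρ q K → ρ + q * K + 1ℤ ≡ (1ℤ + ρ) + q * K
      regroup₁ = solve-∀
      regroup₂ : ∀ q K → K + q * K ≡ + 0 + (q + 1ℤ) * K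
      regroup₂ = solve-∀
      e₁ : ℤ.suc j - r - 1ℤ ≡ + 0 + (q + 1ℤ) * K
      e₁ = trans (shuffle j r) (trans (cong (_+ 1ℤ) e)
             (trans (regroup₁ (+ ρ) q K) (trans (cong (λ z → + z + q * K) 1+ρ≡k) (regroup₂ q K))))
      regroup₃ : ∀ X r q → X + r - (q + 1ℤ) * X ≡ 0ℤ + r - q * X
      regroup₃ = solve-∀
      across : + lookup lam (fromℕ< 0<k) + r - (q + 1ℤ) * M ≤ + lookup lam (fromℕ< ρ<k) + r - q * M
      across = ℤP.≤-trans (ℤP.+-monoˡ-≤ (- ((q + 1ℤ) * M)) (ℤP.+-monoˡ-≤ r (ℤ.+≤+ (lam-bounded (fromℕ< 0<k)))))
                 (ℤP.≤-trans (ℤP.≤-reflexive (regroup₃ M r q)) (ℤP.+-monoˡ-≤ (- (q * M)) (ℤP.+-monoˡ-≤ r (ℤ.+≤+ ℕ.z≤n))))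

  base turns : ℤ → ℤ
  base i  = + suc ((i - 1ℤ) %ℕ k)
  turns i = (i - 1ℤ) /ℕ k

  base<k : ∀ i → (i - 1ℤ) %ℕ k ℕ.< k
  base<k i = n%ℕd<d (i - 1ℤ) k

  base+turns : ∀ i → i ≡ base i + turns i * K
  base+turns i = trans (unshift i) (trans (cong (λ z → 1ℤ + z) (a≡a%ℕn+[a/ℕn]*n (i - 1ℤ) k))
                                          (regroup (+ ((i - 1ℤ) %ℕ k)) (turns i * K)))
    where
    unshift : ∀ i → i ≡ 1ℤ + (i - 1ℤ)
    unshift = solve-∀
    regroup : ∀ a b → 1ℤ + (a + b) ≡ (1ℤ + a) + b
    regroup = solve-∀

  base-period : ∀ i m → base (i + m * K) ≡ base i
  base-period i m = cong (λ z → + suc z) (trans (cong (_%ℕ k) (shuffle i m K)) (proj₂ (divMod-+-multiple (i - 1ℤ) m)))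
    where
    shuffle : ∀ i m K → i + m * K - 1ℤ ≡ i - 1ℤ + m * K
    shuffle = solve-∀

  base-of-row : ∀ s → s ℕ.< k → base (+ suc s) ≡ + suc s
  base-of-row s s<k = cong (λ z → + suc z) (trans (cong (_%ℕ k) (ℤP.pred-suc (+ s))) (proj₂ (divMod-small s s<k)))

  rep-base : ∀ i j → rep k n (i , j) ≡ (base i , j + turns i * M)
  rep-base i j = rep-char i j (turns i) _ (base<k i) (a≡a%ℕn+[a/ℕn]*n (i - 1ℤ) k)

module CylindricDiagram (k n : ℕ) .{{_ : NonZero k}} (lam mu : Vec ℕ k)
                        (lam-partition : IsPartition k n lam) (mu-partition : IsPartition k n mu) (d : ℕ) where

  open import Data.Bool using (Bool; true; false; _∧_; if_then_else_)
  open import Data.Nat as ℕ using (suc)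
  import Data.Nat.Properties as ℕP
  open import Data.Integer as ℤ using (ℤ; +_; _+_; _*_; _-_; -_; _≤_; 1ℤ)
  import Data.Integer.Properties as ℤP
  open import Data.Integer.Tactic.RingSolver using (solve-∀)
  open import Algebra.Bundles using (AbelianGroup)
  open import Algebra.Properties.Group (AbelianGroup.group ℤP.+-0-abelianGroup) using (∙-cancelˡ)
  open import Data.List using (List; map; concatMap; applyUpTo; upTo)
  open import Data.List.Properties using (map-applyUpTo; map-upTo; map-cong; concatMap-cong; map-concatMap)
  open import Data.List.Membership.Propositional using (_∈_)
  open import Data.List.Membership.Propositional.Properties using (∈-applyUpTo⁻; ∈-applyUpTo⁺; ∈-upTo⁺; ∈-upTo⁻)
  open import Data.List.Relation.Unary.Unique.Propositional using (Unique)
  import Data.List.Relation.Unary.Unique.Propositional.Properties as Unique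
  open import Data.Product using (_×_; _,_; proj₁; proj₂; Σ)
  open import Relation.Binary.PropositionalEquality
  open import Defs
  open BoolReflection
  open BenderKnuthMove using (S; P; IsSemistandard)
  open CylinderCoordinates k n
  open IntegerRanges
  open ListCounting
  open Fillings
  open Counting using (count)
  open FiniteSums using (sumTo; sumTo-cong; countᵇ-concatMap)

  lower upper : ℤ → ℤ
  lower i = shiftSeq k n mu (+ 0) i
  upper i = shiftSeq k n lam (+ d) i

  L δ : ℤ → ℕ
  L i = pos (upper i - lower i)
  δ i = pos (lower i - lower (S i))

  lower-antitone : ∀ i → lower (S i) ≤ lower i
  lower-antitone = shiftSeq-antitone mu mu-partition (+ 0)

  δ≡lower-gap : ∀ i → + δ i ≡ lower i - lower (S i)
  δ≡lower-gap i = pos-nonNeg _ (ℤP.i≤j⇒0≤j-i (lower-antitone i))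

  row-end : ∀ i → L (S i) ℕ.≤ δ i ℕ.+ L i
  row-end i = ℕP.≤-trans (pos-mono ends) (pos-+-≤ (lower i - lower (S i)) (upper i - lower i) (ℤP.i≤j⇒0≤j-i (lower-antitone i)))
    where
    telescope : ∀ a b c → a - b + (c - a) ≡ c - b
    telescope = solve-∀
    ends : upper (S i) - lower (S i) ≤ lower i - lower (S i) + (upper i - lower i)
    ends = subst (upper (S i) - lower (S i) ≤_) (sym (telescope (lower i) (lower (S i)) (upper i)))
                 (ℤP.+-monoˡ-≤ (- lower (S i)) (shiftSeq-antitone lam lam-partition (+ d) i))

  lower-period : ∀ i m → lower (i + m * K) ≡ lower i - m * M
  lower-period = shiftSeq-period mu (+ 0)

  upper-period : ∀ i m → upper (i + m * K) ≡ upper i - m * M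
  upper-period = shiftSeq-period lam (+ d)

  private
    cancel-shift : ∀ a b c → a - c - (b - c) ≡ a - b
    cancel-shift = solve-∀

  S-period : ∀ i m → S (i + m * K) ≡ S i + m * K
  S-period i m = sym (ℤP.+-assoc 1ℤ i (m * K))

  P-period : ∀ i m → P (i + m * K) ≡ P i + m * K
  P-period i m = sym (ℤP.+-assoc ℤ.-1ℤ i (m * K))

  L-period : ∀ i m → L (i + m * K) ≡ L i
  L-period i m = cong pos (trans (cong₂ _-_ (upper-period i m) (lower-period i m)) (cancel-shift (upper i) (lower i) (m * M)))

  δ-period : ∀ i m → δ (i + m * K) ≡ δ i
  δ-period i m = cong pos (trans (cong₂ _-_ (lower-period i m) (trans (cong lower (S-period i m)) (lower-period (S i) m)))
                                 (cancel-shift (lower i) (lower (S i)) (m * M)))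

  L-base : ∀ i → L (base i) ≡ L i
  L-base i = trans (sym (L-period (base i) (turns i))) (cong L (sym (base+turns i)))

  cell : ℤ → ℕ → Cell
  cell i x = (i , lower i + 1ℤ + + x)

  rep-cell : ∀ i x → rep k n (cell i x) ≡ cell (base i) x
  rep-cell i x = trans (rep-base i (lower i + 1ℤ + + x))
                       (cong (base i ,_) (trans (regroup (lower i) (+ x) (turns i * M)) (cong (λ z → z + 1ℤ + + x) (sym lower-base))))
    where
    regroup : ∀ a x c → a + 1ℤ + x + c ≡ (a + c) + 1ℤ + x
    regroup = solve-∀
    uncancel : ∀ a c → a - c + c ≡ a
    uncancel = solve-∀
    lower-base : lower (base i) ≡ lower i + turns i * M
    lower-base = sym (trans (cong (λ z → lower z + turns i * M) (base+turns i))
                            (trans (cong (_+ turns i * M) (lower-period (base i) (turns i))) (uncancel (lower (base i)) (turns i * M))))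

  inD-cell : ∀ i y → inD k n lam d mu (cell i y) ≡ (y ℕ.<ᵇ L i)
  inD-cell i y rewrite T⇒≡true (ℤP.≤⇒≤ᵇ (ℤP.i≤i+j (lower i + 1ℤ) (+ y))) = bool-cases (y ℕ.<ᵇ L i) inside outside
    where
    inside : (y ℕ.<ᵇ L i) ≡ true → (lower i + 1ℤ + + y ℤ.≤ᵇ upper i) ≡ (y ℕ.<ᵇ L i)
    inside y<L = trans (T⇒≡true (ℤP.≤⇒≤ᵇ (<width⇒≤ (lower i) (upper i) y (<ᵇ-sound y<L)))) (sym y<L)
    outside : (y ℕ.<ᵇ L i) ≡ false → (lower i + 1ℤ + + y ℤ.≤ᵇ upper i) ≡ (y ℕ.<ᵇ L i)
    outside y≮L = trans (≢true⇒≡false (λ le → true≢false (trans (sym (<ᵇ-complete (within le))) y≮L))) (sym y≮L)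
      where
      within : (lower i + 1ℤ + + y ℤ.≤ᵇ upper i) ≡ true → y ℕ.< L i
      within le = ≤⇒<width (lower i) (upper i) y (ℤP.≤ᵇ⇒≤ (≡true⇒T le))

  cell-right : ∀ i x → (i , proj₂ (cell i x) + 1ℤ) ≡ cell i (suc x)
  cell-right i x = cong (i ,_) (reassoc (lower i) (+ x))
    where
    reassoc : ∀ a x → a + 1ℤ + x + 1ℤ ≡ a + 1ℤ + (1ℤ + x)
    reassoc = solve-∀

  cell-below : ∀ i x → (i + 1ℤ , proj₂ (cell i x)) ≡ cell (S i) (x ℕ.+ δ i)
  cell-below i x = cong₂ _,_ (ℤP.+-comm i 1ℤ)
    (trans (shift (lower i) (lower (S i)) (+ x)) (cong (λ z → lower (S i) + 1ℤ + (+ x + z)) (sym (δ≡lower-gap i))))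
    where
    shift : ∀ a b x → a + 1ℤ + x ≡ b + 1ℤ + (x + (a - b))
    shift = solve-∀

  rowCells : ℕ → List Cell
  rowCells s = applyUpTo (cell (+ suc s)) (L (+ suc s))

  diagram-rows : diagram k n lam d mu ≡ concatMap rowCells (upTo k)
  diagram-rows = concatMap-cong (λ s → trans (cong (map (λ j → (+ suc s , j))) (range-applyUpTo _ _)) (map-applyUpTo _ _ _)) (upTo k)

  diagram-unique : Unique (diagram k n lam d mu)
  diagram-unique = subst Unique (sym diagram-rows)
    (Unique-concatMap rowCells (upTo k) (Unique.upTo⁺ k)
      (λ s _ → Unique.applyUpTo⁺₁ _ _ (λ a<b _ e → ℕP.<-irrefl (cell-injective e) a<b)) rows-disjoint)
    where
    cell-injective : ∀ {s a b} → cell (+ suc s) a ≡ cell (+ suc s) b → a ≡ b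
    cell-injective {s} {a} {b} e = ℤP.+-injective (∙-cancelˡ (lower (+ suc s) + 1ℤ) (+ a) (+ b) (cong proj₂ e))
    rows-disjoint : ∀ s s′ c → s ∈ upTo k → s′ ∈ upTo k → c ∈ rowCells s → c ∈ rowCells s′ → s ≡ s′
    rows-disjoint s s′ c _ _ c∈ c∈′ with ∈-applyUpTo⁻ _ c∈ | ∈-applyUpTo⁻ _ c∈′
    ... | x , _ , refl | x′ , _ , e = ℕP.suc-injective (ℤP.+-injective (cong proj₁ e))

  tabulate : (ℤ → ℕ → ℕ) → Filling
  tabulate V = concatMap (λ s → applyUpTo (λ x → (cell (+ suc s) x , V (+ suc s) x)) (L (+ suc s))) (upTo k)

  tabulate-domain : ∀ V → map proj₁ (tabulate V) ≡ diagram k n lam d mu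
  tabulate-domain V = trans (map-concatMap proj₁ _ (upTo k))
                            (trans (concatMap-cong (λ s → map-applyUpTo _ proj₁ _) (upTo k)) (sym diagram-rows))

  tabulate-cong : ∀ V V′ → (∀ s x → s ℕ.< k → x ℕ.< L (+ suc s) → V (+ suc s) x ≡ V′ (+ suc s) x) →
                  tabulate V ≡ tabulate V′
  tabulate-cong V V′ h = concatMap-cong-local (upTo k)
    (λ s s∈ → applyUpTo-cong _ (λ x x< → cong (cell (+ suc s) x ,_) (h s x (∈-upTo⁻ s∈) x<)))

  ∈-tabulate⁺ : ∀ V s x → s ℕ.< k → x ℕ.< L (+ suc s) → (cell (+ suc s) x , V (+ suc s) x) ∈ tabulate V
  ∈-tabulate⁺ V s x s<k x<L = ∈-concatMap⁺′ (∈-upTo⁺ s<k) (∈-applyUpTo⁺ (λ x → (cell (+ suc s) x , V (+ suc s) x)) x<L)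

  ∈-tabulate⁻ : ∀ V e → e ∈ tabulate V →
                Σ ℕ λ s → Σ ℕ λ x → s ℕ.< k × x ℕ.< L (+ suc s) × e ≡ (cell (+ suc s) x , V (+ suc s) x)
  ∈-tabulate⁻ V e e∈ with ∈-concatMap⁻′ (upTo k) e∈
  ... | s , s∈ , e∈′ with ∈-applyUpTo⁻ _ e∈′
  ...   | x , x<L , refl = s , x , ∈-upTo⁻ s∈ , x<L , refl

  valueAt-tabulate : ∀ V s x → s ℕ.< k → x ℕ.< L (+ suc s) → valueAt (tabulate V) (cell (+ suc s) x) ≡ V (+ suc s) x
  valueAt-tabulate V s x s<k x<L =
    valueAt-∈ (tabulate V) _ _ (subst Unique (sym (tabulate-domain V)) diagram-unique) (∈-tabulate⁺ V s x s<k x<L)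

  rowsOf : Filling → ℤ → ℕ → ℕ
  rowsOf F i x = valueAt F (rep k n (cell i x))

  rowsOf-tabulate : ∀ V i x → x ℕ.< L i → rowsOf (tabulate V) i x ≡ V (base i) x
  rowsOf-tabulate V i x x<L = trans (cong (valueAt (tabulate V)) (rep-cell i x))
                                    (valueAt-tabulate V _ x (base<k i) (subst (x ℕ.<_) (sym (L-base i)) x<L))

  Periodic : (ℤ → ℕ → ℕ) → Set
  Periodic Y = ∀ i m x → Y (i + m * K) x ≡ Y i x

  rowsOf-periodic : ∀ F → Periodic (rowsOf F)
  rowsOf-periodic F i m x =
    cong (valueAt F) (trans (rep-cell (i + m * K) x) (trans (cong (λ z → cell z x) (base-period i m)) (sym (rep-cell i x))))

  periodic-base : ∀ Y → Periodic Y → ∀ i x → Y (base i) x ≡ Y i x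
  periodic-base Y per i x = trans (sym (per (base i) (turns i) x)) (cong (λ z → Y z x) (sym (base+turns i)))

  filling≡tabulate-rowsOf : ∀ l F → F ∈ allFillings l (diagram k n lam d mu) → F ≡ tabulate (rowsOf F)
  filling≡tabulate-rowsOf l F F∈ = begin
    F                                                                   ≡⟨ filling-graph F unique-domain ⟩
    map (λ c → (c , valueAt F c)) (map proj₁ F)                         ≡⟨ cong (map (λ c → (c , valueAt F c))) (trans domain diagram-rows) ⟩
    map (λ c → (c , valueAt F c)) (concatMap rowCells (upTo k))         ≡⟨ map-concatMap (λ c → (c , valueAt F c)) rowCells (upTo k) ⟩
    concatMap (λ s → map (λ c → (c , valueAt F c)) (rowCells s)) (upTo k)
      ≡⟨ concatMap-cong (λ s → map-applyUpTo (cell (+ suc s)) (λ c → (c , valueAt F c)) (L (+ suc s))) (upTo k) ⟩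
    tabulate (λ i x → valueAt F (cell i x))                             ≡⟨ tabulate-cong (λ i x → valueAt F (cell i x)) (rowsOf F) rep-on-base-rows ⟩
    tabulate (rowsOf F)                                                 ∎
    where
    open ≡-Reasoning
    domain : map proj₁ F ≡ diagram k n lam d mu
    domain = allFillings-domain l _ F F∈
    unique-domain : Unique (map proj₁ F)
    unique-domain = subst Unique (sym domain) diagram-unique
    rep-on-base-rows : ∀ s x → s ℕ.< k → x ℕ.< L (+ suc s) → valueAt F (cell (+ suc s) x) ≡ rowsOf F (+ suc s) x
    rep-on-base-rows s x s<k _ = cong (valueAt F) (sym (trans (rep-cell (+ suc s) x) (cong (λ z → cell z x) (base-of-row s s<k))))

  -- The condition `ok` from the `where` block of `isSSCT`, restated here since
  -- it is not exported; the two agree definitionally.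
  semistandardAt : Filling → Cell × ℕ → Bool
  semistandardAt F ((i , j) , v) =
    (if inD k n lam d mu (i , j ℤ.+ ℤ.1ℤ)
       then v ℕ.≤ᵇ valueAt F (rep k n (i , j ℤ.+ ℤ.1ℤ)) else true)
    ∧
    (if inD k n lam d mu (i ℤ.+ ℤ.1ℤ , j)
       then suc v ℕ.≤ᵇ valueAt F (rep k n (i ℤ.+ ℤ.1ℤ , j)) else true)

  weight : Filling → ℕ → List ℕ
  weight F l = map (λ m → countᵇ (λ cv → proj₂ cv ℕ.≡ᵇ suc m) F) (upTo l)

  semistandardAt-cell : ∀ F i x v → semistandardAt F (cell i x , v) ≡
                        ((if suc x ℕ.<ᵇ L i then v ℕ.≤ᵇ rowsOf F i (suc x) else true) ∧
                         (if x ℕ.+ δ i ℕ.<ᵇ L (S i) then suc v ℕ.≤ᵇ rowsOf F (S i) (x ℕ.+ δ i) else true))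
  semistandardAt-cell F i x v =
    trans (cong₂ conditions (cell-right i x) (cell-below i x))
          (cong₂ (λ u w → (if u then v ℕ.≤ᵇ rowsOf F i (suc x) else true) ∧ (if w then suc v ℕ.≤ᵇ rowsOf F (S i) (x ℕ.+ δ i) else true))
                 (inD-cell i (suc x)) (inD-cell (S i) (x ℕ.+ δ i)))
    where
    conditions : Cell → Cell → Bool
    conditions c₁ c₂ = (if inD k n lam d mu c₁ then v ℕ.≤ᵇ valueAt F (rep k n c₁) else true)
                     ∧ (if inD k n lam d mu c₂ then suc v ℕ.≤ᵇ valueAt F (rep k n c₂) else true)

  RowMonoAt ColumnStrictAt : (ℤ → ℕ → ℕ) → ℤ → Set
  RowMonoAt      Y i = ∀ x → suc x ℕ.< L i → Y i x ℕ.≤ Y i (suc x)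
  ColumnStrictAt Y i = ∀ x → x ℕ.< L i → x ℕ.+ δ i ℕ.< L (S i) → Y i x ℕ.< Y (S i) (x ℕ.+ δ i)

  from-base-rows : (Q : ℤ → Set) → (∀ i m → Q i → Q (i + m * K)) → (∀ s → s ℕ.< k → Q (+ suc s)) → ∀ i → Q i
  from-base-rows Q shift base-rows i = subst Q (sym (base+turns i)) (shift (base i) (turns i) (base-rows _ (base<k i)))

  isSemistandard-from-base-rows : ∀ Y → Periodic Y → (∀ s → s ℕ.< k → RowMonoAt Y (+ suc s) × ColumnStrictAt Y (+ suc s)) →
                                  IsSemistandard L δ Y
  isSemistandard-from-base-rows Y per base-rows = record
    { row-end       = row-end
    ; row-mono      = from-base-rows (RowMonoAt Y) row-shift (λ s s<k → proj₁ (base-rows s s<k))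
    ; column-strict = from-base-rows (ColumnStrictAt Y) column-shift (λ s s<k → proj₂ (base-rows s s<k))
    }
    where
    row-shift : ∀ i m → RowMonoAt Y i → RowMonoAt Y (i + m * K)
    row-shift i m mono x 1+x<L = subst₂ ℕ._≤_ (sym (per i m x)) (sym (per i m (suc x))) (mono x (subst (suc x ℕ.<_) (L-period i m) 1+x<L))
    column-shift : ∀ i m → ColumnStrictAt Y i → ColumnStrictAt Y (i + m * K)
    column-shift i m strict x x<L x+δ<L = subst₂ ℕ._<_ (sym (per i m x)) below (strict x (subst (x ℕ.<_) (L-period i m) x<L) x+δ<L′)
      where
      x+δ<L′ : x ℕ.+ δ i ℕ.< L (S i)
      x+δ<L′ = subst₂ (λ u w → x ℕ.+ u ℕ.< w) (δ-period i m) (trans (cong L (S-period i m)) (L-period (S i) m)) x+δ<L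
      below : Y (S i) (x ℕ.+ δ i) ≡ Y (S (i + m * K)) (x ℕ.+ δ (i + m * K))
      below = sym (trans (cong₂ (λ u w → Y u (x ℕ.+ w)) (S-period i m) (δ-period i m)) (per (S i) m (x ℕ.+ δ i)))

  semistandardAt⇒isSemistandard : ∀ V → allᵇ (semistandardAt (tabulate V)) (tabulate V) ≡ true →
                                   IsSemistandard L δ (rowsOf (tabulate V))
  semistandardAt⇒isSemistandard V all-ok = isSemistandard-from-base-rows Y (rowsOf-periodic (tabulate V)) base-rows
    where
    Y = rowsOf (tabulate V)
    base-rows : ∀ s → s ℕ.< k → RowMonoAt Y (+ suc s) × ColumnStrictAt Y (+ suc s)
    base-rows s s<k = mono , strict
      where
      i = + suc s
      V≡Y : ∀ x → x ℕ.< L i → V i x ≡ Y i x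
      V≡Y x x<L = sym (trans (rowsOf-tabulate V i x x<L) (cong (λ z → V z x) (base-of-row s s<k)))
      ok : ∀ x → x ℕ.< L i → _
      ok x x<L = ∧-true⁻ (trans (sym (semistandardAt-cell (tabulate V) i x (V i x)))
                                (allᵇ⁻ (semistandardAt (tabulate V)) (tabulate V) all-ok (∈-tabulate⁺ V s x s<k x<L)))
      mono : RowMonoAt Y i
      mono x 1+x<L = subst (ℕ._≤ Y i (suc x)) (V≡Y x x<L) (≤ᵇ-sound (if-true⁻ (proj₁ (ok x x<L)) (<ᵇ-complete 1+x<L)))
        where x<L = ℕP.<-trans (ℕP.n<1+n x) 1+x<L
      strict : ColumnStrictAt Y i
      strict x x<L x+δ<L = subst (λ z → suc z ℕ.≤ Y (S i) (x ℕ.+ δ i)) (V≡Y x x<L)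
                                 (≤ᵇ-sound (if-true⁻ (proj₂ (ok x x<L)) (<ᵇ-complete x+δ<L)))

  isSemistandard⇒semistandardAt : ∀ Y → IsSemistandard L δ Y → Periodic Y →
                                  allᵇ (semistandardAt (tabulate Y)) (tabulate Y) ≡ true
  isSemistandard⇒semistandardAt Y ss per = allᵇ⁺ (semistandardAt (tabulate Y)) (tabulate Y) ok
    where
    open IsSemistandard ss
    rows≡Y : ∀ i x → x ℕ.< L i → rowsOf (tabulate Y) i x ≡ Y i x
    rows≡Y i x x<L = trans (rowsOf-tabulate Y i x x<L) (periodic-base Y per i x)
    ok : ∀ e → e ∈ tabulate Y → semistandardAt (tabulate Y) e ≡ true
    ok e e∈ with ∈-tabulate⁻ Y e e∈
    ... | s , x , s<k , x<L , refl = trans (semistandardAt-cell (tabulate Y) i x (Y i x)) (∧-true⁺ mono strict)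
      where
      i = + suc s
      mono = if-true⁺ (suc x ℕ.<ᵇ L i) λ 1+x<L →
               ≤ᵇ-complete (subst (Y i x ℕ.≤_) (sym (rows≡Y i (suc x) (<ᵇ-sound 1+x<L))) (row-mono i x (<ᵇ-sound 1+x<L)))
      strict = if-true⁺ (x ℕ.+ δ i ℕ.<ᵇ L (S i)) λ x+δ<L →
                 ≤ᵇ-complete (subst (Y i x ℕ.<_) (sym (rows≡Y (S i) (x ℕ.+ δ i) (<ᵇ-sound x+δ<L))) (column-strict i x x<L (<ᵇ-sound x+δ<L)))

  multiplicity : (ℤ → ℕ → ℕ) → ℕ → ℕ
  multiplicity V v = sumTo (λ s → count (λ x → V (+ suc s) x ℕ.≡ᵇ v) (L (+ suc s))) k

  weight-tabulate : ∀ V l → weight (tabulate V) l ≡ applyUpTo (λ m → multiplicity V (suc m)) l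
  weight-tabulate V l = trans (map-cong (λ m → countᵇ-tabulate (suc m)) (upTo l)) (map-upTo _ l)
    where
    countᵇ-tabulate : ∀ v → countᵇ (λ cv → proj₂ cv ℕ.≡ᵇ v) (tabulate V) ≡ multiplicity V v
    countᵇ-tabulate v =
      trans (countᵇ-concatMap (λ cv → proj₂ cv ℕ.≡ᵇ v) (λ s → applyUpTo (λ x → (cell (+ suc s) x , V (+ suc s) x)) (L (+ suc s))) (λ s → s) k)
            (sumTo-cong k (λ s _ → countᵇ-applyUpTo (λ cv → proj₂ cv ℕ.≡ᵇ v) _ (L (+ suc s))))

module BenderKnuthOnTableaux (k n : ℕ) .{{_ : NonZero k}} (lam mu : Vec ℕ k)
                             (lam-partition : IsPartition k n lam) (mu-partition : IsPartition k n mu) (d : ℕ) where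

  open import Data.Bool using (true; false; _∧_)
  open import Data.Nat as ℕ using (suc; _+_; _≤_; _<_)
  import Data.Nat.Properties as ℕP
  open import Data.Integer as ℤ using (ℤ; +_; _*_; 1ℤ)
  import Data.Integer.Properties as ℤP
  open import Data.List using (List; []; _∷_; [_]; _++_; length; applyUpTo)
  open import Data.List.Properties using (length-++; ++-assoc)
  open import Data.List.Membership.Propositional using (_∈_)
  open import Data.List.Relation.Binary.Permutation.Propositional as ↭ using (_↭_)
  open import Data.Product using (_×_; _,_; proj₁; proj₂; Σ)
  open import Data.Sum using (_⊎_; inj₁; inj₂)
  open import Relation.Binary.PropositionalEquality hiding ([_])
  open import Relation.Nullary using (¬_; yes; no)
  open import Defs
  open BoolReflection
  open Counting using (count; count-cong)
  open BenderKnuthMove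
  open CylinderCoordinates k n using (K)
  open CylindricDiagram k n lam mu lam-partition mu-partition d
  open FiniteSums using (sumTo; sumTo-cong; sumTo-+; sumTo-rotate)
  open Fillings using (allFillings-range; allFillings-complete; allFillings-unique; listEqᵇ-sound; listEqᵇ-refl)
  open ListCounting using (applyUpTo-cong; countᵇ-bijection)
  open Transposition

  private
    D : List Cell
    D = diagram k n lam d mu

  module Move (Y : ℤ → ℕ → ℕ) (ss : IsSemistandard L δ Y) (per : Periodic Y) (a : ℕ) where
    open BenderKnuth L δ Y a
    open Semistandard ss using (bk-row-mono; bk-column-strict)
    open Involution L δ Y a ss using (#a-bk; #b-bk; #a; #b; #other-bk; #paired↓≡#paired↑-below; #free-a)

    private
      #paired↑ : ℕ → ℕ
      #paired↑ s = count (paired↑ (+ suc s)) (L (+ suc s))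

      rowSum : (ℤ → ℕ) → ℕ
      rowSum f = sumTo (λ s → f (+ suc s)) k

    -- Every cell paired downwards sits above one paired upwards, and row k + 1
    -- is row 1 again.
    #paired↓≡#paired↑ : rowSum (λ i → count (paired↓ i) (L i)) ≡ rowSum (λ i → count (paired↑ i) (L i))
    #paired↓≡#paired↑ = trans (sumTo-cong k (λ s _ → #paired↓≡#paired↑-below (+ suc s))) (sumTo-rotate #paired↑ k last≡first)
      where
      k+1≡1+k : + suc k ≡ + 1 ℤ.+ 1ℤ * K
      k+1≡1+k = cong (λ z → + 1 ℤ.+ z) (sym (ℤP.*-identityˡ K))
      last≡first : #paired↑ k ≡ #paired↑ 0
      last≡first = trans (cong (λ j → count (paired↑ j) (L j)) k+1≡1+k)
        (trans (cong (count (paired↑ (+ 1 ℤ.+ 1ℤ * K))) (L-period (+ 1) 1ℤ))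
               (count-cong (L (+ 1)) (λ x _ → paired↑-reindex (λ j → j ℤ.+ 1ℤ * K) (λ j → P-period j 1ℤ)
                                                  (λ j → L-period j 1ℤ) (λ j → δ-period j 1ℤ) (λ j y → per j 1ℤ y) (+ 1) x)))

    multiplicity-a-bk : multiplicity bk a ≡ multiplicity Y (suc a)
    multiplicity-a-bk = begin
      multiplicity bk a                                                         ≡⟨ sumTo-cong k (λ s _ → #a-bk (+ suc s)) ⟩
      rowSum (λ i → count (paired↓ i) (L i) + #free-b i)                        ≡⟨ sumTo-+ _ _ k ⟩
      rowSum (λ i → count (paired↓ i) (L i)) + rowSum #free-b                   ≡⟨ cong (_+ rowSum #free-b) #paired↓≡#paired↑ ⟩
      rowSum (λ i → count (paired↑ i) (L i)) + rowSum #free-b                   ≡⟨ sym (sumTo-+ _ _ k) ⟩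
      rowSum (λ i → count (paired↑ i) (L i) + #free-b i)                        ≡⟨ sym (sumTo-cong k (λ s _ → #b (+ suc s))) ⟩
      multiplicity Y (suc a)                                                    ∎
      where open ≡-Reasoning

    multiplicity-b-bk : multiplicity bk (suc a) ≡ multiplicity Y a
    multiplicity-b-bk = begin
      multiplicity bk (suc a)                                                   ≡⟨ sumTo-cong k (λ s _ → #b-bk (+ suc s)) ⟩
      rowSum (λ i → count (paired↑ i) (L i) + #free-a i)                        ≡⟨ sumTo-+ _ _ k ⟩
      rowSum (λ i → count (paired↑ i) (L i)) + rowSum #free-a                   ≡⟨ cong (_+ rowSum #free-a) (sym #paired↓≡#paired↑) ⟩
      rowSum (λ i → count (paired↓ i) (L i)) + rowSum #free-a                   ≡⟨ sym (sumTo-+ _ _ k) ⟩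
      rowSum (λ i → count (paired↓ i) (L i) + #free-a i)                        ≡⟨ sym (sumTo-cong k (λ s _ → #a (+ suc s))) ⟩
      multiplicity Y a                                                          ∎
      where open ≡-Reasoning

    multiplicity-other-bk : ∀ v → v ≢ a → v ≢ suc a → multiplicity bk v ≡ multiplicity Y v
    multiplicity-other-bk v v≢a v≢b = sumTo-cong k (λ s _ → #other-bk (+ suc s) v v≢a v≢b)

    bk-isSemistandard : IsSemistandard L δ bk
    bk-isSemistandard = record { row-end = row-end ; row-mono = bk-row-mono ; column-strict = bk-column-strict }

    bk-periodic : Periodic bk
    bk-periodic i m x with x ℕP.<? L i
    ... | yes x<L = bk-reindex L δ Y a (λ j → j ℤ.+ m * K) (λ j → S-period j m) (λ j → P-period j m)
                               (λ j → L-period j m) (λ j → δ-period j m) (λ j y → per j m y) i x x<L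
    ... | no  x≮L = trans (bk-unfree (i ℤ.+ m * K) x (outside (i ℤ.+ m * K) x (λ x<L → x≮L (subst (x <_) (L-period i m) x<L))))
                          (trans (per i m x) (sym (bk-unfree i x (outside i x x≮L))))
      where
      outside : ∀ j y → ¬ (y < L j) → free j y ≡ false
      outside j y y≮L = ∧-falseˡ _ (≢true⇒≡false (λ y<L → y≮L (<ᵇ-sound y<L)))

    bk-values : ∀ i x → bk i x ≡ Y i x ⊎ (bk i x ≡ a ⊎ bk i x ≡ suc a)
    bk-values i x = bool-cases (free i x) (λ e → inj₂ (bk-a⊎b i x e)) (λ e → inj₁ (bk-unfree i x e))

    multiplicity-bk-transposeAt : ∀ p → a ≡ suc p → ∀ m → multiplicity bk (suc m) ≡ multiplicity Y (suc (transposeAt p m))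
    multiplicity-bk-transposeAt p refl m with transposeView p m
    ... | at-p refl t≡     = trans multiplicity-a-bk (cong (λ z → multiplicity Y (suc z)) (sym t≡))
    ... | at-1+p refl t≡   = trans multiplicity-b-bk (cong (λ z → multiplicity Y (suc z)) (sym t≡))
    ... | elsewhere m≢p m≢1+p t≡ =
      trans (multiplicity-other-bk (suc m) (λ e → m≢p (ℕP.suc-injective e)) (λ e → m≢1+p (ℕP.suc-injective e)))
            (cong (λ z → multiplicity Y (suc z)) (sym t≡))

    tabulate-bk-∈ : ∀ l → 1 ≤ a → suc a ≤ l → (∀ s x → s < k → x < L (+ suc s) → 1 ≤ Y (+ suc s) x × Y (+ suc s) x ≤ l) →
                    tabulate bk ∈ allFillings l D
    tabulate-bk-∈ l 1≤a 1+a≤l Y-range = allFillings-complete l D (tabulate bk) (tabulate-domain bk) values-in-range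
      where
      bounded : ∀ {w u} → 1 ≤ u × u ≤ l → w ≡ u ⊎ (w ≡ a ⊎ w ≡ suc a) → 1 ≤ w × w ≤ l
      bounded u-range (inj₁ refl)        = u-range
      bounded _       (inj₂ (inj₁ refl)) = 1≤a , ℕP.≤-trans (ℕP.n≤1+n a) 1+a≤l
      bounded _       (inj₂ (inj₂ refl)) = ℕP.≤-trans 1≤a (ℕP.n≤1+n a) , 1+a≤l
      values-in-range : ∀ c v → (c , v) ∈ tabulate bk → 1 ≤ v × v ≤ l
      values-in-range c v cv∈ = in-range (∈-tabulate⁻ bk (c , v) cv∈)
        where
        in-range : (Σ ℕ λ s → Σ ℕ λ x → s < k × x < L (+ suc s) × (c , v) ≡ (cell (+ suc s) x , bk (+ suc s) x)) →
                   1 ≤ v × v ≤ l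
        in-range (s , x , s<k , x<L , cv≡) =
          subst (λ w → 1 ≤ w × w ≤ l) (sym (cong proj₂ cv≡)) (bounded (Y-range s x s<k x<L) (bk-values (+ suc s) x))

    weight-bk : ∀ l (α : List ℕ) x y γ → a ≡ suc (length α) →
                applyUpTo (λ m → multiplicity Y (suc m)) l ≡ α ++ x ∷ y ∷ γ →
                applyUpTo (λ m → multiplicity bk (suc m)) l ≡ α ++ y ∷ x ∷ γ
    weight-bk l α x y γ a≡ weight-Y =
      trans (applyUpTo-cong l (λ m _ → multiplicity-bk-transposeAt (length α) a≡ m))
            (applyUpTo-transposeAt (λ m → multiplicity Y (suc m)) l α x y γ weight-Y)

    tabulate-bk-bk : tabulate (BenderKnuth.bk L δ (rowsOf (tabulate bk)) a) ≡ tabulate Y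
    tabulate-bk-bk = tabulate-cong (BenderKnuth.bk L δ (rowsOf (tabulate bk)) a) Y back
      where
      rows≡bk : ∀ i x → x < L i → rowsOf (tabulate bk) i x ≡ bk i x
      rows≡bk i x x<L = trans (rowsOf-tabulate bk i x x<L) (periodic-base bk bk-periodic i x)
      back : ∀ s x → s < k → x < L (+ suc s) → BenderKnuth.bk L δ (rowsOf (tabulate bk)) a (+ suc s) x ≡ Y (+ suc s) x
      back s x _ x<L = trans (bk-cong L δ (rowsOf (tabulate bk)) bk a rows≡bk (+ suc s) x x<L)
                             (Involution.bk-involutive L δ Y a ss (+ suc s) x x<L)

  isSSCT-tabulate⁻ : ∀ β V → isSSCT k n lam d mu β (tabulate V) ≡ true →
                     IsSemistandard L δ (rowsOf (tabulate V)) × applyUpTo (λ m → multiplicity V (suc m)) (length β) ≡ β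
  isSSCT-tabulate⁻ β V ss with ∧-true⁻ {allᵇ (semistandardAt (tabulate V)) (tabulate V)} ss
  ... | all-ok , weight-ok = semistandardAt⇒isSemistandard V all-ok ,
                             trans (sym (weight-tabulate V (length β))) (listEqᵇ-sound _ β weight-ok)

  isSSCT-tabulate⁺ : ∀ β Y → IsSemistandard L δ Y → Periodic Y →
                     applyUpTo (λ m → multiplicity Y (suc m)) (length β) ≡ β → isSSCT k n lam d mu β (tabulate Y) ≡ true
  isSSCT-tabulate⁺ β Y ss per weight-ok =
    ∧-true⁺ {allᵇ (semistandardAt (tabulate Y)) (tabulate Y)} (isSemistandard⇒semistandardAt Y ss per)
            (subst (λ w → listEqᵇ w β ≡ true) (sym (trans (weight-tabulate Y (length β)) weight-ok)) (listEqᵇ-refl β))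

  length-swap : ∀ (α : List ℕ) x y γ → length (α ++ y ∷ x ∷ γ) ≡ length (α ++ x ∷ y ∷ γ)
  length-swap α x y γ = trans (length-++ α) (sym (length-++ α))

  bkFilling : ℕ → Filling → Filling
  bkFilling a F = tabulate (BenderKnuth.bk L δ (rowsOf F) a)

  bkFilling-swaps : ∀ α x y γ F → F ∈ allFillings (length (α ++ x ∷ y ∷ γ)) D →
                    isSSCT k n lam d mu (α ++ x ∷ y ∷ γ) F ≡ true →
                    bkFilling (suc (length α)) F ∈ allFillings (length (α ++ x ∷ y ∷ γ)) D
                    × isSSCT k n lam d mu (α ++ y ∷ x ∷ γ) (bkFilling (suc (length α)) F) ≡ true
                    × bkFilling (suc (length α)) (bkFilling (suc (length α)) F) ≡ F
  bkFilling-swaps α x y γ F F∈ F-ss =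
    tabulate-bk-∈ l (ℕ.s≤s ℕ.z≤n) 1+a≤l Y-range ,
    isSSCT-tabulate⁺ (α ++ y ∷ x ∷ γ) bk bk-isSemistandard bk-periodic
      (trans (cong (applyUpTo (λ m → multiplicity bk (suc m))) (length-swap α x y γ))
             (weight-bk l α x y γ refl (proj₂ Y-facts))) ,
    trans tabulate-bk-bk (sym F≡)
    where
    β = α ++ x ∷ y ∷ γ
    l = length β
    a = suc (length α)
    Y = rowsOf F
    F≡ : F ≡ tabulate Y
    F≡ = filling≡tabulate-rowsOf l F F∈
    Y-facts : IsSemistandard L δ (rowsOf (tabulate Y)) × applyUpTo (λ m → multiplicity Y (suc m)) l ≡ β
    Y-facts = isSSCT-tabulate⁻ β Y (subst (λ G → isSSCT k n lam d mu β G ≡ true) F≡ F-ss)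
    Y-ss : IsSemistandard L δ Y
    Y-ss = subst (λ G → IsSemistandard L δ (rowsOf G)) (sym F≡) (proj₁ Y-facts)
    open Move Y Y-ss (rowsOf-periodic F) a
    open BenderKnuth L δ Y a using (bk)

    l≡ : l ≡ length α + suc (suc (length γ))
    l≡ = length-++ α
    1+a≤l : suc a ≤ l
    1+a≤l = subst (suc a ≤_) (sym l≡) (subst (_≤ length α + suc (suc (length γ))) (ℕP.+-comm (length α) 2)
                                              (ℕP.+-monoʳ-≤ (length α) (ℕ.s≤s (ℕ.s≤s ℕ.z≤n))))

    Y-range : ∀ s x → s < k → x < L (+ suc s) → 1 ≤ Y (+ suc s) x × Y (+ suc s) x ≤ l
    Y-range s x s<k x<L = allFillings-range l D F F∈ (cell (+ suc s) x) (Y (+ suc s) x)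
                            (subst (λ G → (cell (+ suc s) x , Y (+ suc s) x) ∈ G) (sym F≡) (∈-tabulate⁺ Y s x s<k x<L))

  quantumKostka-swap : ∀ α x y γ → quantumKostka k n lam d mu (α ++ x ∷ y ∷ γ) ≡ quantumKostka k n lam d mu (α ++ y ∷ x ∷ γ)
  quantumKostka-swap α x y γ =
    trans (countᵇ-bijection (isSSCT k n lam d mu β) (isSSCT k n lam d mu β′) (bkFilling a) (bkFilling a)
                            (allFillings l D) (allFillings-unique l D) (bkFilling-swaps α x y γ) backwards)
          (cong (λ l′ → countᵇ (isSSCT k n lam d mu β′) (allFillings l′ D)) (sym (length-swap α x y γ)))
    where
    β  = α ++ x ∷ y ∷ γ
    β′ = α ++ y ∷ x ∷ γ
    l  = length β
    a  = suc (length α)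
    backwards : ∀ F → F ∈ allFillings l D → isSSCT k n lam d mu β′ F ≡ true →
                bkFilling a F ∈ allFillings l D × isSSCT k n lam d mu β (bkFilling a F) ≡ true × bkFilling a (bkFilling a F) ≡ F
    backwards F F∈ F-ss =
      subst (λ l′ → bkFilling a F ∈ allFillings l′ D) (length-swap α x y γ) (proj₁ swapped-back) ,
      proj₂ swapped-back
      where
      swapped-back = bkFilling-swaps α y x γ F (subst (λ l′ → F ∈ allFillings l′ D) (sym (length-swap α x y γ)) F∈) F-ss

  quantumKostka-↭ : ∀ α {β β′} → β ↭ β′ → quantumKostka k n lam d mu (α ++ β) ≡ quantumKostka k n lam d mu (α ++ β′)
  quantumKostka-↭ α ↭.refl = refl
  quantumKostka-↭ α {x ∷ xs} {x ∷ ys} (↭.prep x xs↭ys) =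
    trans (cong Kostka (sym (++-assoc α [ x ] xs)))
          (trans (quantumKostka-↭ (α ++ [ x ]) xs↭ys) (cong Kostka (++-assoc α [ x ] ys)))
    where Kostka = quantumKostka k n lam d mu
  quantumKostka-↭ α {x ∷ y ∷ xs} {y ∷ x ∷ ys} (↭.swap x y xs↭ys) =
    trans (quantumKostka-swap α x y xs)
          (trans (cong Kostka (sym (++-assoc α (y ∷ [ x ]) xs)))
                 (trans (quantumKostka-↭ (α ++ y ∷ [ x ]) xs↭ys) (cong Kostka (++-assoc α (y ∷ [ x ]) ys))))
    where Kostka = quantumKostka k n lam d mu
  quantumKostka-↭ α (↭.trans p q) = trans (quantumKostka-↭ α p) (quantumKostka-↭ α q)


open import Data.Nat using (_<_)
open import Data.List using (List; [])
open import Data.List.Relation.Binary.Permutation.Propositional using (_↭_)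
open import Relation.Binary.PropositionalEquality using (_≡_)
open import Defs using (quantumKostka)

corollary5p3 : (k n : ℕ) .{{_ : NonZero k}} → k < n →
    (lam mu : Vec ℕ k) → IsPartition k n lam → IsPartition k n mu →
    (d : ℕ) → (β β′ : List ℕ) → β ↭ β′ →
    quantumKostka k n lam d mu β ≡ quantumKostka k n lam d mu β′
corollary5p3 k n _ lam mu lam-partition mu-partition d β β′ β↭β′ =
  BenderKnuthOnTableaux.quantumKostka-↭ k n lam mu lam-partition mu-partition d [] β↭β′
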